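{- Let $q$ be an indeterminate and let $M(z)=\sum_{n\ge0}M_n(q)z^n$ be the unique formal power series satisfying $M(z)=1+zM(z)+qz^2M(z)M(qz)$ (the $q$-Motzkin numbers). Then for every $n\ge0$, $$\det\big(M_{i+j}(q)\big)_{i,j=0}^{n}=q^{\frac{n(n+1)(2n+1)}{6}}\qquad\text{and}\qquad \det\big(M_{i+j+1}(q)\big)_{i,j=0}^{n}=q^{2\binom{n+2}{3}}\,d_{n+1},$$ where $(d_m)_{m\ge0}=(1,1,0,-1,-1,0,1,1,0,\dots)$ is periodic with period $6$.
   Context: The first values are $M_0=1$, $M_1=1$, $M_2=1+q$, $M_3=1+2q+q^2$, $M_4=1+3q+3q^2+q^3+q^4$. -}

module Defs where

open import Data.Nat as ℕ using (ℕ; zero; suc; _∸_)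
open import Data.Integer as ℤ using (ℤ; +_; -[1+_])
open import Data.List using (List; []; _∷_; map)
open import Data.Fin using (Fin; zero; suc; toℕ; punchOut)
open import Relation.Binary.PropositionalEquality using (_≡_)

-- Polynomials in q with integer coefficients: coefficient lists,
-- lowest degree first. Equality is coefficientwise (so trailing zeros
-- do not matter).

Poly : Set
Poly = List ℤ

coeff : Poly → ℕ → ℤ
coeff []       _       = + 0
coeff (a ∷ p)  zero    = a
coeff (a ∷ p)  (suc k) = coeff p k

infix 4 _≈_
_≈_ : Poly → Poly → Set
p ≈ r = ∀ k → coeff p k ≡ coeff r k

infixl 6 _+P_
infixl 7 _*P_ _·P_

_+P_ : Poly → Poly → Poly
[]      +P r       = r
(a ∷ p) +P []      = a ∷ p
(a ∷ p) +P (b ∷ r) = (a ℤ.+ b) ∷ (p +P r)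

_·P_ : ℤ → Poly → Poly
c ·P p = map (c ℤ.*_) p

_*P_ : Poly → Poly → Poly
[]      *P r = []
(a ∷ p) *P r = (a ·P r) +P (+ 0 ∷ (p *P r))

-P_ : Poly → Poly
-P p = map ℤ.-_ p

constP : ℤ → Poly
constP c = c ∷ []

0P 1P qP : Poly
0P = []
1P = constP (+ 1)
qP = + 0 ∷ + 1 ∷ []

q^ : ℕ → Poly
q^ zero    = 1P
q^ (suc k) = qP *P q^ k

-- Formal power series in z with coefficients in ℤ[q]:
-- F = Σ_n F n z^n.

FPS : Set
FPS = ℕ → Poly

sumTo : ℕ → (ℕ → Poly) → Poly
sumTo zero    f = f zero
sumTo (suc n) f = sumTo n f +P f (suc n)

oneS : FPS
oneS zero    = 1P
oneS (suc _) = 0P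

_+S_ : FPS → FPS → FPS
(F +S G) n = F n +P G n

zS : FPS → FPS
zS F zero    = 0P
zS F (suc n) = F n

_·S_ : Poly → FPS → FPS
(c ·S F) n = c *P F n

_*S_ : FPS → FPS → FPS
(F *S G) n = sumTo n (λ k → F k *P G (n ∸ k))

substQz : FPS → FPS
substQz F n = q^ n *P F n

IsQMotzkinGF : FPS → Set
IsQMotzkinGF M =
  ∀ n → M n ≈ (oneS +S (zS M +S (qP ·S zS (zS (M *S substQz M))))) n

minor : ∀ {n} → Fin (suc n) → (Fin (suc n) → Fin (suc n) → Poly)
      → Fin n → Fin n → Poly
minor i A r c = A (Data.Fin.punchIn i r) (suc c)

sign : ℕ → Poly → Poly
sign zero          p = p
sign (suc zero)    p = -P p
sign (suc (suc k)) p = sign k p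

sumFin : ∀ n → (Fin n → Poly) → Poly
sumFin zero    f = 0P
sumFin (suc n) f = f zero +P sumFin n (λ i → f (suc i))

det : ∀ n → (Fin n → Fin n → Poly) → Poly
det zero    A = 1P
det (suc n) A = sumFin (suc n) (λ i → sign (toℕ i) (A i zero *P det n (minor i A)))

d : ℕ → ℤ
d 0 = + 1
d 1 = + 1
d 2 = + 0
d 3 = -[1+ 0 ]
d 4 = -[1+ 0 ]
d 5 = + 0
d (suc (suc (suc (suc (suc (suc m)))))) = d m

{-# OPTIONS --safe #-}
-- M is the J-fraction with coefficients bₖ = qᵏ and λₖ₊₁ = q²ᵏ⁺¹. With
-- Vₖ(z) = M(z) M(qz) ⋯ M(qᵏz) and V₋₁ = 1, the functional equation gives
-- Vₖ = Vₖ₋₁ + qᵏ z Vₖ + q²ᵏ⁺¹ z² Vₖ₊₁, and this says that the monic polynomials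
-- pₖ₊₁ = (x − bₖ) pₖ − λₖ pₖ₋₁ satisfy L(xʲ pₖ) = q^(k²) [z^(j−k)] Vₖ for the
-- functional L(xʲ) = Mⱼ: the pₖ are orthogonal, with L(pₖ²) = q^(k²).
-- Row reduction by the unitriangular matrix of coefficients of the pₖ turns the
-- Hankel matrix (M₍ᵢ₊ⱼ₎) into a triangular one with diagonal q^(k²), and, done on
-- both sides, (M₍ᵢ₊ⱼ₊₁₎) into the tridiagonal matrix (L(x pₖ pₗ)) with diagonal
-- q^(k²+k) and off-diagonal q^((k+1)²). In the continuant recurrence for its
-- determinants both terms carry the same power of q, leaving dₘ₊₂ = dₘ₊₁ − dₘ.
module Submission where

open import Defs
open import Data.Nat as ℕ using (ℕ; zero; suc; _+_; _*_; _∸_; _/_; _<_; _≤_)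
import Data.Nat.Properties as ℕ
open import Data.Nat.Combinatorics using (_C_; nCk+nC[k+1]≡[n+1]C[k+1]; nC1≡n)
open import Data.Nat.DivMod using (m*n/n≡m)
import Data.Nat.Tactic.RingSolver as ℕ-Solver
open import Data.Integer as ℤ using (+_)
import Data.Integer.Properties as ℤ
open import Data.Fin as Fin using (Fin; zero; suc; toℕ; inject₁; punchIn; punchOut)
open import Data.Fin.Properties using (suc-injective; toℕ-injective; toℕ-inject₁; toℕ-fromℕ; toℕ-fromℕ<; toℕ<n;
  punchIn-injective; punchIn-punchOut; punchInᵢ≢i) renaming (_≟_ to _≟ᶠ_)
open import Data.Vec.Functional using (updateAt)
open import Data.Vec.Functional.Properties using (updateAt-updates; updateAt-minimal; updateAt-commutes; updateAt-id-local)
open import Data.List using ([]; _∷_)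
open import Data.Maybe as Maybe using (Maybe; just; nothing)
open import Data.Empty using (⊥-elim)
open import Data.Product using (Σ; _×_; _,_)
open import Data.Sum using (_⊎_; inj₁; inj₂)
open import Function using (_∘_; const)
open import Level using (0ℓ)
open import Relation.Nullary using (¬_; yes; no)
open import Relation.Binary using (tri<; tri≈; tri>)
open import Relation.Binary.PropositionalEquality as ≡ using (_≡_; _≢_; refl; cong; cong₂; cong-app)
open import Algebra.Bundles using (AbelianGroup; CommutativeRing; CommutativeSemiring)
open import Algebra.Structures using (IsAbelianGroup)
open import Algebra.Morphism.Structures using (IsGroupMonomorphism)
import Algebra.Construct.Pointwise ℕ as Pointwise
import Algebra.Morphism.GroupMonomorphism as GroupMonomorphism
open import Algebra.Properties.Monoid.Sum ℕ.+-0-monoid using (sum-syntax; sum-init-last; sum-cong-≗)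
open import Tactic.RingSolver using (solve-∀)
open import Tactic.RingSolver.Core.AlmostCommutativeRing using (AlmostCommutativeRing; fromCommutativeRing)

sum-snoc : ∀ n (x : ℕ → ℕ) → ∑[ i < suc n ] x (toℕ i) ≡ ∑[ i < n ] x (toℕ i) + x n
sum-snoc n x = ≡.trans (sum-init-last (x ∘ toℕ))
  (cong₂ _+_ (sum-cong-≗ {n} (cong x ∘ toℕ-inject₁)) (cong x (toℕ-fromℕ n)))

sumOfSquares : ∀ n → ∑[ i < suc n ] (toℕ i * toℕ i) ≡ (n * (n + 1) * (2 * n + 1)) / 6
sumOfSquares n = ≡.trans (≡.sym (m*n/n≡m _ 6)) (cong (_/ 6) (six-times n))
  where
  open ≡.≡-Reasoning
  six-times : ∀ n → ∑[ i < suc n ] (toℕ i * toℕ i) * 6 ≡ n * (n + 1) * (2 * n + 1)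
  six-times zero    = refl
  six-times (suc n) = begin
    ∑[ i < suc (suc n) ] (toℕ i * toℕ i) * 6                 ≡⟨ cong (_* 6) (sum-snoc (suc n) (λ i → i * i)) ⟩
    (∑[ i < suc n ] (toℕ i * toℕ i) + suc n * suc n) * 6    ≡⟨ ℕ.*-distribʳ-+ 6 (∑[ i < suc n ] (toℕ i * toℕ i)) (suc n * suc n) ⟩
    ∑[ i < suc n ] (toℕ i * toℕ i) * 6 + suc n * suc n * 6  ≡⟨ cong (_+ suc n * suc n * 6) (six-times n) ⟩
    n * (n + 1) * (2 * n + 1) + suc n * suc n * 6            ≡⟨ step n ⟩
    suc n * (suc n + 1) * (2 * suc n + 1)                    ∎
    where
    step : ∀ n → n * (n + 1) * (2 * n + 1) + suc n * suc n * 6 ≡ suc n * (suc n + 1) * (2 * suc n + 1)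
    step = ℕ-Solver.solve-∀

sumOfPronics : ∀ n → ∑[ i < suc n ] (toℕ i * toℕ i + toℕ i) ≡ 2 * ((n + 2) C 3)
sumOfPronics zero    = refl
sumOfPronics (suc n) = begin
  ∑[ i < suc (suc n) ] (toℕ i * toℕ i + toℕ i)        ≡⟨ sum-snoc (suc n) (λ i → i * i + i) ⟩
  ∑[ i < suc n ] (toℕ i * toℕ i + toℕ i) + (suc n * suc n + suc n)
    ≡⟨ cong₂ _+_ (sumOfPronics n) (≡.sym (twice-C2 (suc n))) ⟩
  2 * ((n + 2) C 3) + 2 * (suc (suc n) C 2)            ≡⟨ cong (λ m → 2 * ((n + 2) C 3) + 2 * (m C 2)) (ℕ.+-comm 2 n) ⟩
  2 * ((n + 2) C 3) + 2 * ((n + 2) C 2)                ≡⟨ ≡.sym (ℕ.*-distribˡ-+ 2 ((n + 2) C 3) ((n + 2) C 2)) ⟩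
  2 * ((n + 2) C 3 + (n + 2) C 2)                      ≡⟨ cong (2 *_) (ℕ.+-comm ((n + 2) C 3) ((n + 2) C 2)) ⟩
  2 * ((n + 2) C 2 + (n + 2) C 3)                      ≡⟨ cong (2 *_) (nCk+nC[k+1]≡[n+1]C[k+1] (n + 2) 2) ⟩
  2 * ((suc n + 2) C 3)                                ∎
  where
  open ≡.≡-Reasoning
  twice-C2 : ∀ m → 2 * (suc m C 2) ≡ m * m + m
  twice-C2 zero    = refl
  twice-C2 (suc m) = begin
    2 * (suc (suc m) C 2)                ≡⟨ cong (2 *_) (≡.sym (nCk+nC[k+1]≡[n+1]C[k+1] (suc m) 1)) ⟩
    2 * (suc m C 1 + suc m C 2)          ≡⟨ ℕ.*-distribˡ-+ 2 (suc m C 1) (suc m C 2) ⟩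
    2 * (suc m C 1) + 2 * (suc m C 2)    ≡⟨ cong₂ (λ a b → 2 * a + b) (nC1≡n (suc m)) (twice-C2 m) ⟩
    2 * suc m + (m * m + m)              ≡⟨ rearrange m ⟩
    suc m * suc m + suc m                ∎
    where
    rearrange : ∀ m → 2 * suc m + (m * m + m) ≡ suc m * suc m + suc m
    rearrange = ℕ-Solver.solve-∀

-- The ring ℤ[q]

-- `p ≈ r` unfolds to a function type from which Agda cannot recover `p`
-- and `r`; the record makes them inferable.
infix 4 _≋_
record _≋_ (p r : Poly) : Set where
  constructor mk
  field get : p ≈ r
open _≋_ public

coeff-+P : ∀ p r k → coeff (p +P r) k ≡ coeff p k ℤ.+ coeff r k
coeff-+P []      r       k       = ≡.sym (ℤ.+-identityˡ _)
coeff-+P (a ∷ p) []      k       = ≡.sym (ℤ.+-identityʳ _)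
coeff-+P (a ∷ p) (b ∷ r) zero    = refl
coeff-+P (a ∷ p) (b ∷ r) (suc k) = coeff-+P p r k

coeff-·P : ∀ c p k → coeff (c ·P p) k ≡ c ℤ.* coeff p k
coeff-·P c []      k       = ≡.sym (ℤ.*-zeroʳ c)
coeff-·P c (a ∷ p) zero    = refl
coeff-·P c (a ∷ p) (suc k) = coeff-·P c p k

coeff--P : ∀ p k → coeff (-P p) k ≡ ℤ.- coeff p k
coeff--P []      k       = refl
coeff--P (a ∷ p) zero    = refl
coeff--P (a ∷ p) (suc k) = coeff--P p k

-- The additive group of ℤ[q] is pulled back along the injective map
-- `coeff` from the group of integer sequences.
+P-isAbelianGroup : IsAbelianGroup _≋_ _+P_ [] -P_
+P-isAbelianGroup = GroupMonomorphism.isAbelianGroup coeff-isGroupMonomorphism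
  (AbelianGroup.isAbelianGroup sequences)
  where
  sequences : AbelianGroup 0ℓ 0ℓ
  sequences = Pointwise.abelianGroup ℤ.+-0-abelianGroup
  coeff-isGroupMonomorphism : IsGroupMonomorphism
    (record { Carrier = Poly ; _≈_ = _≋_ ; _∙_ = _+P_ ; ε = [] ; _⁻¹ = -P_ })
    (AbelianGroup.rawGroup sequences) coeff
  coeff-isGroupMonomorphism = record
    { isGroupHomomorphism = record
      { isMonoidHomomorphism = record
        { isMagmaHomomorphism = record
          { isRelHomomorphism = record { cong = get }
          ; homo = coeff-+P }
        ; ε-homo = λ _ → refl }
      ; ⁻¹-homo = coeff--P }
    ; injective = mk }

+P-abelianGroup : AbelianGroup 0ℓ 0ℓ
+P-abelianGroup = record { isAbelianGroup = +P-isAbelianGroup }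

open AbelianGroup +P-abelianGroup using (setoid)
  renaming (refl to ≋-refl; sym to ≋-sym; trans to ≋-trans; ∙-cong to +P-cong)
open AbelianGroup +P-abelianGroup using (identityʳ; commutativeSemigroup)
open import Algebra.Properties.CommutativeSemigroup commutativeSemigroup using (interchange; x∙yz≈y∙xz)

≡⇒≋ : ∀ {p r} → p ≡ r → p ≋ r
≡⇒≋ refl = ≋-refl

∷-cong : ∀ {a b p r} → a ≡ b → p ≋ r → a ∷ p ≋ b ∷ r
∷-cong a≡b (mk p≈r) = mk λ { zero → a≡b ; (suc k) → p≈r k }

·P-cong : ∀ c {p r} → p ≋ r → c ·P p ≋ c ·P r
·P-cong c {p} {r} (mk p≈r) = mk λ k →
  ≡.trans (coeff-·P c p k) (≡.trans (cong (c ℤ.*_) (p≈r k)) (≡.sym (coeff-·P c r k)))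

·P-distribˡ : ∀ c p r → c ·P (p +P r) ≋ c ·P p +P c ·P r
·P-distribˡ c p r = mk λ k → ≡.trans (coeff-·P c (p +P r) k) (≡.trans (cong (c ℤ.*_) (coeff-+P p r k))
  (≡.trans (ℤ.*-distribˡ-+ c (coeff p k) _)
  (≡.sym (≡.trans (coeff-+P (c ·P p) (c ·P r) k) (cong₂ ℤ._+_ (coeff-·P c p k) (coeff-·P c r k))))))

·P-distribʳ : ∀ c d p → (c ℤ.+ d) ·P p ≋ c ·P p +P d ·P p
·P-distribʳ c d p = mk λ k → ≡.trans (coeff-·P (c ℤ.+ d) p k) (≡.trans (ℤ.*-distribʳ-+ (coeff p k) c d)
  (≡.sym (≡.trans (coeff-+P (c ·P p) (d ·P p) k) (cong₂ ℤ._+_ (coeff-·P c p k) (coeff-·P d p k)))))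

·P-assoc : ∀ c d p → (c ℤ.* d) ·P p ≋ c ·P (d ·P p)
·P-assoc c d p = mk λ k → ≡.trans (coeff-·P (c ℤ.* d) p k) (≡.trans (ℤ.*-assoc c d (coeff p k))
  (≡.sym (≡.trans (coeff-·P c (d ·P p) k) (cong (c ℤ.*_) (coeff-·P d p k)))))

·P-zeroˡ : ∀ p → + 0 ·P p ≋ []
·P-zeroˡ p = mk λ k → ≡.trans (coeff-·P (+ 0) p k) (ℤ.*-zeroˡ (coeff p k))

·P-identityˡ : ∀ p → + 1 ·P p ≋ p
·P-identityˡ p = mk λ k → ≡.trans (coeff-·P (+ 1) p k) (ℤ.*-identityˡ (coeff p k))

*P-zeroˡ : ∀ p r → p ≋ [] → p *P r ≋ []
*P-zeroˡ []      r _        = ≋-refl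
*P-zeroˡ (a ∷ p) r (mk p≈0) = mk λ k →
  ≡.trans (coeff-+P (a ·P r) (+ 0 ∷ p *P r) k) (cong₂ ℤ._+_ (a·r≈0 k) (shifted k))
  where
  a·r≈0 : ∀ k → coeff (a ·P r) k ≡ + 0
  a·r≈0 k = ≡.trans (coeff-·P a r k) (≡.trans (cong (ℤ._* coeff r k) (p≈0 zero)) (ℤ.*-zeroˡ (coeff r k)))
  shifted : ∀ k → coeff (+ 0 ∷ p *P r) k ≡ + 0
  shifted zero    = refl
  shifted (suc k) = get (*P-zeroˡ p r (mk (p≈0 ∘ suc))) k

*P-zeroʳ : ∀ p → p *P [] ≋ []
*P-zeroʳ []      = ≋-refl
*P-zeroʳ (a ∷ p) = mk λ { zero → refl ; (suc k) → get (*P-zeroʳ p) k }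

*P-congˡ : ∀ {p p′} r → p ≋ p′ → p *P r ≋ p′ *P r
*P-congˡ {[]}    {p′}     r p≈p′ = ≋-sym (*P-zeroˡ p′ r (≋-sym p≈p′))
*P-congˡ {a ∷ p} {[]}     r p≈p′ = *P-zeroˡ (a ∷ p) r p≈p′
*P-congˡ {a ∷ p} {b ∷ p′} r (mk p≈p′) =
  +P-cong (≡⇒≋ (cong (_·P r) (p≈p′ zero))) (∷-cong refl (*P-congˡ {p} {p′} r (mk (p≈p′ ∘ suc))))

*P-congʳ : ∀ p {r r′} → r ≋ r′ → p *P r ≋ p *P r′
*P-congʳ []      r≈r′ = ≋-refl
*P-congʳ (a ∷ p) r≈r′ = +P-cong (·P-cong a r≈r′) (∷-cong refl (*P-congʳ p r≈r′))

*P-distribʳ : ∀ p r s → (p +P r) *P s ≋ p *P s +P r *P s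
*P-distribʳ []      r       s = ≋-refl
*P-distribʳ (a ∷ p) []      s = ≋-sym (identityʳ _)
*P-distribʳ (a ∷ p) (b ∷ r) s = ≋-trans
  (+P-cong (·P-distribʳ a b s) (∷-cong (≡.sym (ℤ.+-identityʳ (+ 0))) (*P-distribʳ p r s)))
  (interchange (a ·P s) (b ·P s) (+ 0 ∷ p *P s) (+ 0 ∷ r *P s))

*P-distribˡ : ∀ p r s → p *P (r +P s) ≋ p *P r +P p *P s
*P-distribˡ []      r s = ≋-refl
*P-distribˡ (a ∷ p) r s = ≋-trans
  (+P-cong (·P-distribˡ a r s) (∷-cong (≡.sym (ℤ.+-identityʳ (+ 0))) (*P-distribˡ p r s)))
  (interchange (a ·P r) (a ·P s) (+ 0 ∷ p *P r) (+ 0 ∷ p *P s))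

·P-*P : ∀ c p r → (c ·P p) *P r ≋ c ·P (p *P r)
·P-*P c []      r = ≋-refl
·P-*P c (a ∷ p) r = ≋-trans
  (+P-cong (·P-assoc c a r) (∷-cong (≡.sym (ℤ.*-zeroʳ c)) (·P-*P c p r)))
  (≋-sym (·P-distribˡ c (a ·P r) (+ 0 ∷ p *P r)))

*P-∷ : ∀ p b r → p *P (b ∷ r) ≋ b ·P p +P (+ 0 ∷ p *P r)
*P-∷ []      b r = mk λ { zero → refl ; (suc k) → refl }
*P-∷ (a ∷ p) b r = ∷-cong (≡.trans (ℤ.+-identityʳ _) (≡.trans (ℤ.*-comm a b) (≡.sym (ℤ.+-identityʳ _))))
  (≋-trans (+P-cong (≋-refl {a ·P r}) (*P-∷ p b r)) (x∙yz≈y∙xz (a ·P r) (b ·P p) (+ 0 ∷ p *P r)))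

*P-comm : ∀ p r → p *P r ≋ r *P p
*P-comm []      r = ≋-sym (*P-zeroʳ r)
*P-comm (a ∷ p) r = ≋-trans (+P-cong (≋-refl {a ·P r}) (∷-cong refl (*P-comm p r))) (≋-sym (*P-∷ r a p))

*P-assoc : ∀ p r s → (p *P r) *P s ≋ p *P (r *P s)
*P-assoc []      r s = ≋-refl
*P-assoc (a ∷ p) r s = ≋-trans (*P-distribʳ (a ·P r) (+ 0 ∷ p *P r) s)
  (+P-cong (·P-*P a r s) (≋-trans (+P-cong (·P-zeroˡ s) ≋-refl) (∷-cong refl (*P-assoc p r s))))

*P-identityˡ : ∀ p → 1P *P p ≋ p
*P-identityˡ p = ≋-trans (+P-cong (·P-identityˡ p) (mk λ { zero → refl ; (suc k) → refl })) (identityʳ p)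

*P-identityʳ : ∀ p → p *P 1P ≋ p
*P-identityʳ p = ≋-trans (*P-comm p 1P) (*P-identityˡ p)

ℤ[q] : CommutativeRing 0ℓ 0ℓ
ℤ[q] = record { isCommutativeRing = record
  { isRing = record
    { +-isAbelianGroup = +P-isAbelianGroup
    ; *-cong = λ {p} {p′} {r} {r′} p≈p′ r≈r′ → ≋-trans (*P-congˡ r p≈p′) (*P-congʳ p′ r≈r′)
    ; *-assoc = *P-assoc
    ; *-identity = *P-identityˡ , *P-identityʳ
    ; distrib = *P-distribˡ , λ s p r → *P-distribʳ p r s }
  ; *-comm = *P-comm } }

-- The solver drops only the constants recognised here as zero; these also
-- arise as + 0 ∷ …, e.g. from 1P +P -P 1P.
ℤ[q]-ACR : AlmostCommutativeRing 0ℓ 0ℓ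
ℤ[q]-ACR = fromCommutativeRing ℤ[q] isZero
  where
  isZero : ∀ p → Maybe ([] ≋ p)
  isZero []        = just ≋-refl
  isZero (+ 0 ∷ p) = Maybe.map (λ e → mk λ { zero → refl ; (suc k) → get e k }) (isZero p)
  isZero _         = nothing

open CommutativeRing ℤ[q] using (+-cong; +-congˡ; +-congʳ; *-cong; *-congˡ; *-congʳ; +-identityˡ; +-identityʳ;
  *-identityˡ; *-identityʳ; zeroˡ; zeroʳ; -‿cong; +-comm; *-comm; *-assoc; distribˡ)
open import Algebra.Properties.Ring (CommutativeRing.ring ℤ[q]) using (-1*x≈-x; x+x≈x⇒x≈0)
open import Algebra.Properties.Group (AbelianGroup.group +P-abelianGroup) using (inverseˡ-unique)
open import Algebra.Properties.Semiring.Exp (CommutativeRing.semiring ℤ[q]) using (_^_; ^-homo-*)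
open import Algebra.Definitions.RawSemiring (CommutativeSemiring.rawSemiring (CommutativeRing.commutativeSemiring ℤ[q]))
  using (product)
import Algebra.Properties.Monoid.Sum (CommutativeRing.*-monoid ℤ[q]) as Product
open import Relation.Binary.Reasoning.Setoid setoid

q^≡qP^ : ∀ n → q^ n ≡ qP ^ n
q^≡qP^ zero    = refl
q^≡qP^ (suc n) = cong (qP *P_) (q^≡qP^ n)

q^-homo-+ : ∀ m n → q^ (m + n) ≋ q^ m *P q^ n
q^-homo-+ m n rewrite q^≡qP^ m | q^≡qP^ n | q^≡qP^ (m + n) = ^-homo-* qP m n

product-q^ : ∀ m (x : ℕ → ℕ) → product {m} (λ i → q^ (x (toℕ i))) ≋ q^ (∑[ i < m ] x (toℕ i))
product-q^ zero    x = ≋-refl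
product-q^ (suc m) x = ≋-trans (*-congˡ {q^ (x 0)} (product-q^ m (x ∘ suc))) (≋-sym (q^-homo-+ (x 0) _))

sumFin-cong : ∀ n {f g : Fin n → Poly} → (∀ i → f i ≋ g i) → sumFin n f ≋ sumFin n g
sumFin-cong zero    f≈g = ≋-refl
sumFin-cong (suc n) f≈g = +-cong (f≈g zero) (sumFin-cong n (f≈g ∘ suc))

sumFin-zero : ∀ n {f : Fin n → Poly} → (∀ i → f i ≋ []) → sumFin n f ≋ []
sumFin-zero zero    f≈0 = ≋-refl
sumFin-zero (suc n) f≈0 = ≋-trans (+-cong (f≈0 zero) (sumFin-zero n (f≈0 ∘ suc))) (+-identityˡ [])

sumFin-distrib-+ : ∀ n (f g : Fin n → Poly) → sumFin n (λ i → f i +P g i) ≋ sumFin n f +P sumFin n g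
sumFin-distrib-+ zero    f g = ≋-sym (+-identityˡ [])
sumFin-distrib-+ (suc n) f g = ≋-trans (+-congˡ (sumFin-distrib-+ n (f ∘ suc) (g ∘ suc)))
  (interchange (f zero) (g zero) (sumFin n (f ∘ suc)) (sumFin n (g ∘ suc)))

*-distribˡ-sumFin : ∀ n c (f : Fin n → Poly) → c *P sumFin n f ≋ sumFin n (λ i → c *P f i)
*-distribˡ-sumFin zero    c f = zeroʳ c
*-distribˡ-sumFin (suc n) c f = ≋-trans (distribˡ c (f zero) _) (+-congˡ (*-distribˡ-sumFin n c (f ∘ suc)))

sumFin-comm : ∀ m n (f : Fin m → Fin n → Poly) →
  sumFin m (λ i → sumFin n (f i)) ≋ sumFin n (λ j → sumFin m (λ i → f i j))
sumFin-comm zero    n f = ≋-sym (sumFin-zero n (λ _ → ≋-refl))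
sumFin-comm (suc m) n f = ≋-trans (+-congˡ (sumFin-comm m n (f ∘ suc)))
  (≋-sym (sumFin-distrib-+ n (f zero) (λ j → sumFin m (λ i → f (suc i) j))))

sumFin-single : ∀ n (f : Fin n → Poly) t → (∀ i → i ≢ t → f i ≋ []) → sumFin n f ≋ f t
sumFin-single (suc n) f zero    f≈0 =
  ≋-trans (+-congˡ (sumFin-zero n (λ i → f≈0 (suc i) λ ()))) (+-identityʳ (f zero))
sumFin-single (suc n) f (suc t) f≈0 =
  ≋-trans (+-congʳ (f≈0 zero λ ())) (≋-trans (+-identityˡ _)
    (sumFin-single n (f ∘ suc) t (λ i i≢t → f≈0 (suc i) (i≢t ∘ suc-injective))))

sumFin-pair : ∀ n (f : Fin n → Poly) a b → a ≢ b → (∀ i → i ≢ a → i ≢ b → f i ≋ []) →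
  sumFin n f ≋ f a +P f b
sumFin-pair (suc n) f zero    zero    a≢b _   = ⊥-elim (a≢b refl)
sumFin-pair (suc n) f zero    (suc b) _   f≈0 =
  +-congˡ (sumFin-single n (f ∘ suc) b (λ i i≢b → f≈0 (suc i) (λ ()) (i≢b ∘ suc-injective)))
sumFin-pair (suc n) f (suc a) zero    _   f≈0 = ≋-trans
  (+-congˡ (sumFin-single n (f ∘ suc) a (λ i i≢a → f≈0 (suc i) (i≢a ∘ suc-injective) (λ ()))))
  (+-comm (f zero) (f (suc a)))
sumFin-pair (suc n) f (suc a) (suc b) a≢b f≈0 =
  ≋-trans (+-congʳ (f≈0 zero (λ ()) (λ ()))) (≋-trans (+-identityˡ _)
    (sumFin-pair n (f ∘ suc) a b (a≢b ∘ cong suc)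
      (λ i i≢a i≢b → f≈0 (suc i) (i≢a ∘ suc-injective) (i≢b ∘ suc-injective))))

sumFin-threeTerm : ∀ n c (x y z : Fin n → Poly) →
  sumFin n (λ i → x i +P -P (c *P y i) +P -P (z i)) ≋ sumFin n x +P -P (c *P sumFin n y) +P -P (sumFin n z)
sumFin-threeTerm zero    c x y z = ≋-sym (zero≈ c)
  where
  zero≈ : ∀ c → [] +P -P (c *P []) +P -P [] ≋ []
  zero≈ = solve-∀ ℤ[q]-ACR
sumFin-threeTerm (suc n) c x y z = ≋-trans (+-congˡ (sumFin-threeTerm n c (x ∘ suc) (y ∘ suc) (z ∘ suc)))
  (regroup c (x zero) (y zero) (z zero) (sumFin n (x ∘ suc)) (sumFin n (y ∘ suc)) (sumFin n (z ∘ suc)))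
  where
  regroup : ∀ c a b d X Y Z → (a +P -P (c *P b) +P -P d) +P (X +P -P (c *P Y) +P -P Z) ≋
                              (a +P X) +P -P (c *P (b +P Y)) +P -P (d +P Z)
  regroup = solve-∀ ℤ[q]-ACR

*-distribʳ-sumFin : ∀ n c (f : Fin n → Poly) → sumFin n f *P c ≋ sumFin n (λ i → f i *P c)
*-distribʳ-sumFin n c f = ≋-trans (*-comm (sumFin n f) c)
  (≋-trans (*-distribˡ-sumFin n c f) (sumFin-cong n (λ i → *-comm c (f i))))

sumFin-linear : ∀ n c (x y z : Fin n → Poly) →
  sumFin n (λ i → x i +P c *P y i +P z i) ≋ sumFin n x +P c *P sumFin n y +P sumFin n z
sumFin-linear zero    c x y z = ≋-sym (zero≈ c)
  where
  zero≈ : ∀ c → [] +P c *P [] +P [] ≋ []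
  zero≈ = solve-∀ ℤ[q]-ACR
sumFin-linear (suc n) c x y z = ≋-trans (+-congˡ (sumFin-linear n c (x ∘ suc) (y ∘ suc) (z ∘ suc)))
  (regroup c (x zero) (y zero) (z zero) (sumFin n (x ∘ suc)) (sumFin n (y ∘ suc)) (sumFin n (z ∘ suc)))
  where
  regroup : ∀ c a b d X Y Z → (a +P c *P b +P d) +P (X +P c *P Y +P Z) ≋ (a +P X) +P c *P (b +P Y) +P (d +P Z)
  regroup = solve-∀ ℤ[q]-ACR

sign-as-* : ∀ k p → sign k p ≋ sign k 1P *P p
sign-as-* zero          p = ≋-sym (*-identityˡ p)
sign-as-* (suc zero)    p = ≋-sym (-1*x≈-x p)
sign-as-* (suc (suc k)) p = sign-as-* k p

sign-suc : ∀ k → sign (suc k) 1P ≋ -P sign k 1P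
sign-suc zero          = ≋-refl
sign-suc (suc zero)    = mk λ { zero → refl ; (suc _) → refl }
sign-suc (suc (suc k)) = sign-suc k

sign-cong : ∀ k {p r} → p ≋ r → sign k p ≋ sign k r
sign-cong k {p} {r} p≈r = ≋-trans (sign-as-* k p) (≋-trans (*-congˡ {sign k 1P} p≈r) (≋-sym (sign-as-* k r)))

sign-zero : ∀ k {p} → p ≋ [] → sign k p ≋ []
sign-zero k {p} p≈0 = ≋-trans (sign-as-* k p) (≋-trans (*-congˡ {sign k 1P} p≈0) (zeroʳ (sign k 1P)))

sign-linear : ∀ k c x y → sign k (c *P x +P y) ≋ c *P sign k x +P sign k y
sign-linear k c x y = begin
  sign k (c *P x +P y)               ≈⟨ sign-as-* k _ ⟩
  s *P (c *P x +P y)                 ≈⟨ distribute s c x y ⟩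
  c *P (s *P x) +P s *P y            ≈⟨ +-cong (*-congˡ {c} (≋-sym (sign-as-* k x))) (≋-sym (sign-as-* k y)) ⟩
  c *P sign k x +P sign k y          ∎
  where
  s = sign k 1P
  distribute : ∀ s c x y → s *P (c *P x +P y) ≋ c *P (s *P x) +P s *P y
  distribute = solve-∀ ℤ[q]-ACR

sign-cancel : ∀ k p → sign k p +P sign (suc k) p ≋ []
sign-cancel k p = begin
  sign k p +P sign (suc k) p              ≈⟨ +-cong (sign-as-* k p) (sign-as-* (suc k) p) ⟩
  s *P p +P sign (suc k) 1P *P p          ≈⟨ +-congˡ (*-congʳ (sign-suc k)) ⟩
  s *P p +P -P s *P p                     ≈⟨ cancel s p ⟩
  []                                      ∎
  where
  s = sign k 1P
  cancel : ∀ s p → s *P p +P -P s *P p ≋ []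
  cancel = solve-∀ ℤ[q]-ACR

-- Determinants

Matrix : ℕ → Set
Matrix n = Fin n → Fin n → Poly

rows-≗⇒≋ : ∀ {n} {X Y : Matrix n} → (∀ i → X i ≡ Y i) → ∀ i j → X i j ≋ Y i j
rows-≗⇒≋ X≡Y i j = ≡⇒≋ (cong-app (X≡Y i) j)

det-cong : ∀ n {X Y : Matrix n} → (∀ i j → X i j ≋ Y i j) → det n X ≋ det n Y
det-cong zero    X≈Y = ≋-refl
det-cong (suc n) X≈Y = sumFin-cong (suc n) λ i →
  sign-cong (toℕ i) (*-cong (X≈Y i zero) (det-cong n λ r c → X≈Y (punchIn i r) (suc c)))

AgreeOffRow : ∀ {n} → Fin n → Matrix n → Matrix n → Set
AgreeOffRow r X Y = ∀ i → i ≢ r → ∀ j → X i j ≋ Y i j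

minor-agreeOffRow : ∀ {n} {X Z : Matrix (suc n)} {r i} (i≢r : i ≢ r) → AgreeOffRow r X Z →
  AgreeOffRow (punchOut i≢r) (minor i X) (minor i Z)
minor-agreeOffRow {i = i} i≢r X~Z k k≢r′ j = X~Z (punchIn i k) punchIn≢r (suc j)
  where
  punchIn≢r : punchIn i k ≢ _
  punchIn≢r eq = k≢r′ (punchIn-injective i k _ (≡.trans eq (≡.sym (punchIn-punchOut i≢r))))

det-minor-agreeOffRow : ∀ {n} {X Z : Matrix (suc n)} {r} → AgreeOffRow r X Z → det n (minor r X) ≋ det n (minor r Z)
det-minor-agreeOffRow {n} {r = r} X~Z = det-cong n λ k j → X~Z (punchIn r k) (punchInᵢ≢i r k) (suc j)

det-linear : ∀ n (X Y Z : Matrix n) r c → AgreeOffRow r X Z → AgreeOffRow r Y Z →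
  (∀ j → Z r j ≋ c *P X r j +P Y r j) → det n Z ≋ c *P det n X +P det n Y
det-linear (suc n) X Y Z r c X~Z Y~Z Zᵣ = begin
  det (suc n) Z                                    ≈⟨ sumFin-cong (suc n) expand ⟩
  sumFin (suc n) (λ i → c *P term X i +P term Y i) ≈⟨ sumFin-distrib-+ (suc n) (λ i → c *P term X i) (term Y) ⟩
  sumFin (suc n) (λ i → c *P term X i) +P det (suc n) Y
    ≈⟨ +-congʳ (≋-sym (*-distribˡ-sumFin (suc n) c (term X))) ⟩
  c *P det (suc n) X +P det (suc n) Y              ∎
  where
  term : Matrix (suc n) → Fin (suc n) → Poly
  term W i = sign (toℕ i) (W i zero *P det n (minor i W))
  linearˡ : ∀ a b c d → (c *P a +P b) *P d ≋ c *P (a *P d) +P b *P d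
  linearˡ = solve-∀ ℤ[q]-ACR
  linearʳ : ∀ a c x y → a *P (c *P x +P y) ≋ c *P (a *P x) +P a *P y
  linearʳ = solve-∀ ℤ[q]-ACR
  expand : ∀ i → term Z i ≋ c *P term X i +P term Y i
  expand i with i ≟ᶠ r
  ... | yes refl = ≋-trans (sign-cong (toℕ i) (begin
        Z i zero *P det n (minor i Z)                            ≈⟨ *-congʳ (Zᵣ zero) ⟩
        (c *P X i zero +P Y i zero) *P det n (minor i Z)         ≈⟨ linearˡ (X i zero) (Y i zero) c (det n (minor i Z)) ⟩
        c *P (X i zero *P det n (minor i Z)) +P Y i zero *P det n (minor i Z)
          ≈⟨ +-cong (*-congˡ {c} (*-congˡ {X i zero} (≋-sym (det-minor-agreeOffRow X~Z))))
                    (*-congˡ {Y i zero} (≋-sym (det-minor-agreeOffRow Y~Z))) ⟩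
        c *P (X i zero *P det n (minor i X)) +P Y i zero *P det n (minor i Y) ∎))
      (sign-linear (toℕ i) c _ _)
  ... | no i≢r = ≋-trans (sign-cong (toℕ i) (begin
        Z i zero *P det n (minor i Z)
          ≈⟨ *-congˡ {Z i zero} (det-linear n (minor i X) (minor i Y) (minor i Z) (punchOut i≢r) c
               (minor-agreeOffRow i≢r X~Z) (minor-agreeOffRow i≢r Y~Z)
               (λ j → ≡.subst (λ w → Z w (suc j) ≋ c *P X w (suc j) +P Y w (suc j))
                              (≡.sym (punchIn-punchOut i≢r)) (Zᵣ (suc j)))) ⟩
        Z i zero *P (c *P det n (minor i X) +P det n (minor i Y))
          ≈⟨ linearʳ (Z i zero) c (det n (minor i X)) (det n (minor i Y)) ⟩
        c *P (Z i zero *P det n (minor i X)) +P Z i zero *P det n (minor i Y)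
          ≈⟨ +-cong (*-congˡ {c} (*-congʳ (≋-sym (X~Z i i≢r zero)))) (*-congʳ (≋-sym (Y~Z i i≢r zero))) ⟩
        c *P (X i zero *P det n (minor i X)) +P Y i zero *P det n (minor i Y) ∎))
      (sign-linear (toℕ i) c _ _)

det-zeroRow : ∀ n (X : Matrix n) r → (∀ j → X r j ≋ []) → det n X ≋ []
det-zeroRow n X r Xᵣ≈0 = x+x≈x⇒x≈0 (det n X) (≋-sym (≋-trans
  (det-linear n X X X r 1P (λ _ _ _ → ≋-refl) (λ _ _ _ → ≋-refl) Xᵣ≈Xᵣ+Xᵣ)
  (+-congʳ (*-identityˡ (det n X)))))
  where
  Xᵣ≈Xᵣ+Xᵣ : ∀ j → X r j ≋ 1P *P X r j +P X r j
  Xᵣ≈Xᵣ+Xᵣ j = ≋-trans (Xᵣ≈0 j) (≋-sym (≋-trans (+-cong (*-congˡ {1P} (Xᵣ≈0 j)) (Xᵣ≈0 j)) (≋-trans (+-identityʳ _) (zeroʳ 1P))))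

infixl 5 _[_]≔_
_[_]≔_ : ∀ {n} → Matrix n → Fin n → (Fin n → Poly) → Matrix n
X [ r ]≔ v = updateAt X r (const v)

≔-updates : ∀ {n} (X : Matrix n) r v → (X [ r ]≔ v) r ≡ v
≔-updates X r v = updateAt-updates r X

≔-minimal : ∀ {n} (X : Matrix n) {i r} v → i ≢ r → (X [ r ]≔ v) i ≡ X i
≔-minimal X {i} {r} v i≢r = updateAt-minimal i r X i≢r

det-≔-linear : ∀ n (X : Matrix n) r c u v →
  det n (X [ r ]≔ (λ j → c *P u j +P v j)) ≋ c *P det n (X [ r ]≔ u) +P det n (X [ r ]≔ v)
det-≔-linear n X r c u v = det-linear n (X [ r ]≔ u) (X [ r ]≔ v) (X [ r ]≔ w) r c
  (offRow u) (offRow v) rowᵣ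
  where
  w : Fin n → Poly
  w j = c *P u j +P v j
  offRow : ∀ u → AgreeOffRow r (X [ r ]≔ u) (X [ r ]≔ w)
  offRow u i i≢r j = ≡⇒≋ (cong-app (≡.trans (≔-minimal X u i≢r) (≡.sym (≔-minimal X w i≢r))) j)
  rowᵣ : ∀ j → (X [ r ]≔ w) r j ≋ c *P (X [ r ]≔ u) r j +P (X [ r ]≔ v) r j
  rowᵣ j rewrite ≔-updates X r w | ≔-updates X r u | ≔-updates X r v = ≋-refl

≔-cong : ∀ {n} (X : Matrix n) r {v w} → (∀ j → v j ≋ w j) → ∀ i j → (X [ r ]≔ v) i j ≋ (X [ r ]≔ w) i j
≔-cong X r {v} {w} v≈w i j with i ≟ᶠ r
... | yes refl rewrite ≔-updates X i v | ≔-updates X i w = v≈w j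
... | no i≢r   rewrite ≔-minimal X v i≢r | ≔-minimal X w i≢r = ≋-refl

det-≔-additive : ∀ n (X : Matrix n) r u v →
  det n (X [ r ]≔ (λ j → u j +P v j)) ≋ det n (X [ r ]≔ u) +P det n (X [ r ]≔ v)
det-≔-additive n X r u v = begin
  det n (X [ r ]≔ (λ j → u j +P v j))              ≈⟨ det-cong n (≔-cong X r (λ j → +-congʳ (≋-sym (*-identityˡ (u j))))) ⟩
  det n (X [ r ]≔ (λ j → 1P *P u j +P v j))        ≈⟨ det-≔-linear n X r 1P u v ⟩
  1P *P det n (X [ r ]≔ u) +P det n (X [ r ]≔ v)   ≈⟨ +-congʳ (*-identityˡ (det n (X [ r ]≔ u))) ⟩
  det n (X [ r ]≔ u) +P det n (X [ r ]≔ v)         ∎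

det-≔-sum : ∀ m n (X : Matrix n) r (c : Fin m → Poly) (V : Fin m → Fin n → Poly) →
  det n (X [ r ]≔ (λ j → sumFin m (λ k → c k *P V k j))) ≋ sumFin m (λ k → c k *P det n (X [ r ]≔ V k))
det-≔-sum zero    n X r c V = det-zeroRow n _ r (λ j → ≡⇒≋ (cong-app (≔-updates X r _) j))
det-≔-sum (suc m) n X r c V = ≋-trans (det-≔-linear n X r (c zero) (V zero) _)
  (+-congˡ (det-≔-sum m n X r (c ∘ suc) (V ∘ suc)))

punchIn-adjacent : ∀ {n} (a k : Fin n) →
  punchIn (inject₁ a) k ≡ punchIn (suc a) k ⊎ (punchIn (inject₁ a) k ≡ suc a × punchIn (suc a) k ≡ inject₁ a)
punchIn-adjacent zero    zero    = inj₂ (refl , refl)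
punchIn-adjacent zero    (suc k) = inj₁ refl
punchIn-adjacent (suc a) zero    = inj₁ refl
punchIn-adjacent (suc a) (suc k) with punchIn-adjacent a k
... | inj₁ eq         = inj₁ (cong suc eq)
... | inj₂ (eq₁ , eq₂) = inj₂ (cong suc eq₁ , cong suc eq₂)

punchOut-adjacent : ∀ {n} (i : Fin (suc (suc n))) (a : Fin (suc n)) (i≢a : i ≢ inject₁ a) (i≢a+1 : i ≢ suc a) →
  Σ (Fin n) λ a′ → punchOut i≢a ≡ inject₁ a′ × punchOut i≢a+1 ≡ suc a′
punchOut-adjacent zero          zero    i≢a _     = ⊥-elim (i≢a refl)
punchOut-adjacent zero          (suc a) _   _     = a , refl , refl
punchOut-adjacent (suc zero)    zero    _   i≢a+1 = ⊥-elim (i≢a+1 refl)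
punchOut-adjacent {suc n} (suc (suc i)) zero _ _ = zero , refl , refl
punchOut-adjacent {suc n} (suc i) (suc a) i≢a i≢a+1
  with punchOut-adjacent i a (i≢a ∘ cong suc) (i≢a+1 ∘ cong suc)
... | a′ , eq₁ , eq₂ = suc a′ , cong suc eq₁ , cong suc eq₂

det-adjacentEqualRows : ∀ n (X : Matrix (suc n)) a → (∀ j → X (inject₁ a) j ≋ X (suc a) j) → det (suc n) X ≋ []
det-adjacentEqualRows zero    X ()
det-adjacentEqualRows (suc n) X a Xₐ≈Xₐ₊₁ =
  ≋-trans (sumFin-pair (suc (suc n)) term (inject₁ a) (suc a) inject₁≢suc vanishing) cancel
  where
  term : Fin (suc (suc n)) → Poly
  term i = sign (toℕ i) (X i zero *P det (suc n) (minor i X))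
  inject₁≢suc : inject₁ a ≢ suc a
  inject₁≢suc eq = ℕ.1+n≢n (≡.trans (≡.sym (cong toℕ eq)) (toℕ-inject₁ a))
  vanishing : ∀ i → i ≢ inject₁ a → i ≢ suc a → term i ≋ []
  vanishing i i≢a i≢a+1 with punchOut-adjacent i a i≢a i≢a+1
  ... | a′ , eq₁ , eq₂ = sign-zero (toℕ i) (≋-trans
        (*-congˡ {X i zero} (det-adjacentEqualRows n (minor i X) a′ λ j → ≡.subst₂ (λ k l → X k (suc j) ≋ X l (suc j))
          (≡.trans (≡.sym (punchIn-punchOut i≢a)) (cong (punchIn i) eq₁))
          (≡.trans (≡.sym (punchIn-punchOut i≢a+1)) (cong (punchIn i) eq₂)) (Xₐ≈Xₐ₊₁ (suc j))))
        (zeroʳ (X i zero)))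
  minors≈ : ∀ k j → minor (inject₁ a) X k j ≋ minor (suc a) X k j
  minors≈ k j with punchIn-adjacent a k
  ... | inj₁ eq = ≡⇒≋ (cong (λ l → X l (suc j)) eq)
  ... | inj₂ (eq₁ , eq₂) rewrite eq₁ | eq₂ = ≋-sym (Xₐ≈Xₐ₊₁ (suc j))
  cancel : term (inject₁ a) +P term (suc a) ≋ []
  cancel = begin
    term (inject₁ a) +P term (suc a)
      ≈⟨ +-congʳ (≡⇒≋ (cong (λ k → sign k (X (inject₁ a) zero *P det (suc n) (minor (inject₁ a) X))) (toℕ-inject₁ a))) ⟩
    sign (toℕ a) t +P sign (suc (toℕ a)) (X (suc a) zero *P det (suc n) (minor (suc a) X))
      ≈⟨ +-congˡ (sign-cong (suc (toℕ a)) (*-cong (≋-sym (Xₐ≈Xₐ₊₁ zero)) (≋-sym (det-cong (suc n) minors≈)))) ⟩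
    sign (toℕ a) t +P sign (suc (toℕ a)) t  ≈⟨ sign-cancel (toℕ a) t ⟩
    []                                      ∎
    where
    t = X (inject₁ a) zero *P det (suc n) (minor (inject₁ a) X)

det-swapAdjacentRows : ∀ n (X : Matrix (suc n)) a u w →
  det (suc n) (X [ inject₁ a ]≔ u [ suc a ]≔ w) ≋ -P det (suc n) (X [ inject₁ a ]≔ w [ suc a ]≔ u)
det-swapAdjacentRows n X a u w = inverseˡ-unique (D u w) (D w u) (begin
  D u w +P D w u                              ≈⟨ expand ⟩
  (D u u +P D u w) +P (D w u +P D w w)       ≈⟨ ≋-sym (+-cong (additiveʳ u u w) (additiveʳ w u w)) ⟩
  D u (u ⊕ w) +P D w (u ⊕ w)                  ≈⟨ ≋-sym (additiveˡ u w (u ⊕ w)) ⟩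
  D (u ⊕ w) (u ⊕ w)                           ≈⟨ equal (u ⊕ w) ⟩
  []                                          ∎)
  where
  _⊕_ : (Fin (suc n) → Poly) → (Fin (suc n) → Poly) → Fin (suc n) → Poly
  (u ⊕ w) j = u j +P w j
  D : (Fin (suc n) → Poly) → (Fin (suc n) → Poly) → Poly
  D u w = det (suc n) (X [ inject₁ a ]≔ u [ suc a ]≔ w)
  inject₁≢suc : inject₁ a ≢ suc a
  inject₁≢suc eq = ℕ.1+n≢n (≡.trans (≡.sym (cong toℕ eq)) (toℕ-inject₁ a))
  equal : ∀ v → D v v ≋ []
  equal v = det-adjacentEqualRows n (X [ inject₁ a ]≔ v [ suc a ]≔ v) a λ j → ≡⇒≋ (cong-app (≡.trans (≔-minimal (X [ inject₁ a ]≔ v) v inject₁≢suc)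
    (≡.trans (≔-updates X (inject₁ a) v) (≡.sym (≔-updates (X [ inject₁ a ]≔ v) (suc a) v)))) j)
  additiveʳ : ∀ u v w → D u (v ⊕ w) ≋ D u v +P D u w
  additiveʳ u v w = det-≔-additive (suc n) (X [ inject₁ a ]≔ u) (suc a) v w
  commute : ∀ u w → ∀ i j → (X [ inject₁ a ]≔ u [ suc a ]≔ w) i j ≋ (X [ suc a ]≔ w [ inject₁ a ]≔ u) i j
  commute u w i j = ≡⇒≋ (cong-app (≡.sym (updateAt-commutes (inject₁ a) (suc a) inject₁≢suc X i)) j)
  additiveˡ : ∀ u v w → D (u ⊕ v) w ≋ D u w +P D v w
  additiveˡ u v w = begin
    D (u ⊕ v) w  ≈⟨ det-cong (suc n) (commute (u ⊕ v) w) ⟩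
    det (suc n) (X [ suc a ]≔ w [ inject₁ a ]≔ (u ⊕ v))
      ≈⟨ det-≔-additive (suc n) (X [ suc a ]≔ w) (inject₁ a) u v ⟩
    det (suc n) (X [ suc a ]≔ w [ inject₁ a ]≔ u) +P det (suc n) (X [ suc a ]≔ w [ inject₁ a ]≔ v)
      ≈⟨ ≋-sym (+-cong (det-cong (suc n) (commute u w)) (det-cong (suc n) (commute v w))) ⟩
    D u w +P D v w ∎
  expand : D u w +P D w u ≋ (D u u +P D u w) +P (D w u +P D w w)
  expand = begin
    D u w +P D w u ≈⟨ ≋-sym (+-cong (+-identityˡ (D u w)) (+-identityʳ (D w u))) ⟩
    ([] +P D u w) +P (D w u +P [])
      ≈⟨ ≋-sym (+-cong (+-congʳ {D u w} (equal u)) (+-congˡ {D w u} (equal w))) ⟩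
    (D u u +P D u w) +P (D w u +P D w w) ∎

det-equalRows-at : ∀ d n (X : Matrix (suc n)) i c → toℕ c ≡ d ℕ.+ toℕ i →
  (∀ j → X i j ≋ X (suc c) j) → det (suc n) X ≋ []
det-equalRows-at zero n X i c c≡i Xᵢ≈Xc = det-adjacentEqualRows n X c
  (λ j → ≡.subst (λ k → X k j ≋ X (suc c) j) i≡c (Xᵢ≈Xc j))
  where
  i≡c : i ≡ inject₁ c
  i≡c = toℕ-injective (≡.trans (≡.sym c≡i) (≡.sym (toℕ-inject₁ c)))
det-equalRows-at (suc d) (suc n) X i (suc c) c≡ Xᵢ≈Xc = begin
  det (suc (suc n)) X    ≈⟨ det-cong (suc (suc n)) (rows-≗⇒≋ (λ k → ≡.sym (unchanged k))) ⟩
  det (suc (suc n)) (X [ a ]≔ X a [ b ]≔ X b)  ≈⟨ det-swapAdjacentRows (suc n) X (suc c) (X a) (X b) ⟩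
  -P det (suc (suc n)) X′                      ≈⟨ -‿cong (det-equalRows-at d (suc n) X′ i (inject₁ c) c′≡ X′ᵢ≈X′ₐ) ⟩
  -P []                                        ≈⟨ ≋-refl ⟩
  []                                           ∎
  where
  a b : Fin (suc (suc n))
  a = inject₁ (suc c)
  b = suc (suc c)
  X′ : Matrix (suc (suc n))
  X′ = X [ a ]≔ X b [ b ]≔ X a
  unchanged : ∀ k → (X [ a ]≔ X a [ b ]≔ X b) k ≡ X k
  unchanged k = ≡.trans (updateAt-id-local b (X [ a ]≔ X a) (≡.sym (updateAt-id-local a X refl b)) k)
                        (updateAt-id-local a X refl k)
  c′≡ : toℕ (inject₁ c) ≡ d ℕ.+ toℕ i
  c′≡ = ≡.trans (toℕ-inject₁ c) (ℕ.suc-injective c≡)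
  i≢a : i ≢ a
  i≢a i≡a = ℕ.m≢1+n+m (toℕ i) (≡.trans (cong toℕ i≡a) (≡.trans (toℕ-inject₁ (suc c)) c≡))
  i≢b : i ≢ b
  i≢b i≡b = ℕ.m≢1+n+m (toℕ i) (≡.trans (cong toℕ i≡b) (cong suc c≡))
  a≢b : a ≢ b
  a≢b a≡b = ℕ.1+n≢n (≡.trans (≡.sym (cong toℕ a≡b)) (toℕ-inject₁ (suc c)))
  X′ᵢ≈X′ₐ : ∀ j → X′ i j ≋ X′ a j
  X′ᵢ≈X′ₐ j rewrite ≔-minimal (X [ a ]≔ X b) (X a) i≢b | ≔-minimal X (X b) i≢a
                  | ≔-minimal (X [ a ]≔ X b) (X a) a≢b | ≔-updates X a (X b) = Xᵢ≈Xc j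

det-equalRows : ∀ n (X : Matrix n) i j → toℕ i ℕ.< toℕ j → (∀ k → X i k ≋ X j k) → det n X ≋ []
det-equalRows (suc n) X i (suc c) i<j =
  det-equalRows-at (toℕ c ℕ.∸ toℕ i) n X i c (≡.sym (ℕ.m∸n+n≡m (ℕ.s≤s⁻¹ i<j)))

matMul : ∀ {n} → Matrix n → Matrix n → Matrix n
matMul {n} L X k j = sumFin n (λ i → L k i *P X i j)

record IsLowerUnitriangular {n} (L : Matrix n) : Set where
  field
    diagonal : ∀ k → L k k ≋ 1P
    upper    : ∀ k i → toℕ k ℕ.< toℕ i → L k i ≋ []

-- Row t of L X is replaced by row t of X, for t = 0, 1, …, n − 1: this
-- subtracts multiples of the rows above, which are already rows of X.
module RowByRow {n} (L X : Matrix n) where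

  partial : ℕ → Matrix n
  partial t k with toℕ k ℕ.<? t
  ... | yes _ = X k
  ... | no  _ = matMul L X k

  partial-below : ∀ t k → toℕ k ℕ.< t → partial t k ≡ X k
  partial-below t k k<t with toℕ k ℕ.<? t
  ... | yes _   = refl
  ... | no  k≮t = ⊥-elim (k≮t k<t)

  partial-above : ∀ t k → ¬ toℕ k ℕ.< t → partial t k ≡ matMul L X k
  partial-above t k k≮t with toℕ k ℕ.<? t
  ... | yes k<t = ⊥-elim (k≮t k<t)
  ... | no  _   = refl

  partial-suc : ∀ t k → toℕ k ≢ t → partial t k ≡ partial (suc t) k
  partial-suc t k k≢t with toℕ k ℕ.<? t | toℕ k ℕ.<? suc t
  ... | yes _   | yes _     = refl
  ... | yes k<t | no k≮t+1  = ⊥-elim (k≮t+1 (ℕ.m<n⇒m<1+n k<t))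
  ... | no k≮t  | yes k<t+1 = ⊥-elim (k≮t (ℕ.≤∧≢⇒< (ℕ.s≤s⁻¹ k<t+1) k≢t))
  ... | no _    | no _      = refl

  det-partial-suc : IsLowerUnitriangular L → ∀ t → t ℕ.< n → det n (partial t) ≋ det n (partial (suc t))
  det-partial-suc L-unitriangular t t<n = begin
    det n (partial t)                                     ≈⟨ det-cong n (rows-≗⇒≋ λ k → ≡.sym (updateAt-id-local r (partial t) (≡.sym partialᵣ) k)) ⟩
    det n (partial t [ r ]≔ matMul L X r)                 ≈⟨ det-≔-sum n n (partial t) r (L r) X ⟩
    sumFin n (λ i → L r i *P det n (partial t [ r ]≔ X i)) ≈⟨ sumFin-single n _ r vanishing ⟩
    L r r *P det n (partial t [ r ]≔ X r)                 ≈⟨ ≋-trans (*-congʳ (diagonal r)) (*-identityˡ _) ⟩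
    det n (partial t [ r ]≔ X r)                          ≈⟨ det-cong n (rows-≗⇒≋ replaced) ⟩
    det n (partial (suc t))                               ∎
    where
    open IsLowerUnitriangular L-unitriangular
    r : Fin n
    r = Fin.fromℕ< t<n
    r≡t : toℕ r ≡ t
    r≡t = toℕ-fromℕ< t<n
    partialᵣ : partial t r ≡ matMul L X r
    partialᵣ = partial-above t r (ℕ.<-irrefl r≡t)
    vanishing : ∀ i → i ≢ r → L r i *P det n (partial t [ r ]≔ X i) ≋ []
    vanishing i i≢r with ℕ.<-cmp (toℕ r) (toℕ i)
    ... | tri< r<i _ _ = ≋-trans (*-congʳ (upper r i r<i)) (zeroˡ (det n (partial t [ r ]≔ X i)))
    ... | tri≈ _ r≡i _ = ⊥-elim (i≢r (toℕ-injective (≡.sym r≡i)))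
    ... | tri> _ _ i<r = ≋-trans (*-congˡ {L r i} (det-equalRows n (partial t [ r ]≔ X i) i r i<r λ j →
            ≡⇒≋ (cong-app (≡.trans (≔-minimal (partial t) (X i) i≢r)
              (≡.trans (partial-below t i (≡.subst (toℕ i ℕ.<_) r≡t i<r)) (≡.sym (≔-updates (partial t) r (X i))))) j)))
          (zeroʳ (L r i))
    replaced : ∀ k → (partial t [ r ]≔ X r) k ≡ partial (suc t) k
    replaced k with k ≟ᶠ r
    ... | yes refl = ≡.trans (≔-updates (partial t) k (X k))
                       (≡.sym (partial-below (suc t) k (≡.subst (ℕ._< suc t) (≡.sym r≡t) (ℕ.n<1+n t))))
    ... | no k≢r   = ≡.trans (≔-minimal (partial t) (X r) k≢r)
                       (partial-suc t k λ k≡t → k≢r (toℕ-injective (≡.trans k≡t (≡.sym r≡t))))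

det-lowerUnitriangular-matMul : ∀ n (L X : Matrix n) → IsLowerUnitriangular L → det n (matMul L X) ≋ det n X
det-lowerUnitriangular-matMul n L X L-unitriangular = begin
  det n (matMul L X)  ≈⟨ det-cong n (rows-≗⇒≋ λ k → ≡.sym (partial-above 0 k λ ())) ⟩
  det n (partial 0)   ≈⟨ steps n 0 (ℕ.+-identityʳ n) ⟩
  det n (partial n)   ≈⟨ det-cong n (rows-≗⇒≋ λ k → partial-below n k (toℕ<n k)) ⟩
  det n X             ∎
  where
  open RowByRow L X
  steps : ∀ s t → s ℕ.+ t ≡ n → det n (partial t) ≋ det n (partial n)
  steps zero    t refl  = ≋-refl
  steps (suc s) t s+t≡n = ≋-trans (det-partial-suc L-unitriangular t (≡.subst (t ℕ.<_) s+t≡n (ℕ.s≤s (ℕ.m≤n+m t s))))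
                                  (steps s (suc t) (≡.trans (ℕ.+-suc s t) s+t≡n))

det-upperTriangular : ∀ n (X : Matrix n) → (∀ i j → toℕ j ℕ.< toℕ i → X i j ≋ []) → det n X ≋ product (λ i → X i i)
det-upperTriangular zero    X _     = ≋-refl
det-upperTriangular (suc n) X upper = ≋-trans (sumFin-single (suc n) _ zero vanishing)
  (*-congˡ {X zero zero} (det-upperTriangular n (minor zero X) λ i j j<i → upper (suc i) (suc j) (ℕ.s<s j<i)))
  where
  vanishing : ∀ i → i ≢ zero → sign (toℕ i) (X i zero *P det n (minor i X)) ≋ []
  vanishing zero    0≢0 = ⊥-elim (0≢0 refl)
  vanishing (suc i) _   = sign-zero (toℕ (suc i)) (≋-trans (*-congʳ (upper (suc i) zero ℕ.z<s)) (zeroˡ (det n (minor (suc i) X))))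

minorᵀ : ∀ {n} → Fin (suc n) → Matrix (suc n) → Matrix n
minorᵀ j X r c = X (suc r) (punchIn j c)

sign-*-sumFin : ∀ k n a (f : Fin n → Poly) → sign k (a *P sumFin n f) ≋ sumFin n (λ j → sign k (a *P f j))
sign-*-sumFin k n a f = begin
  sign k (a *P sumFin n f)                         ≈⟨ sign-cong k (*-distribˡ-sumFin n a f) ⟩
  sign k (sumFin n (λ j → a *P f j))               ≈⟨ sign-as-* k _ ⟩
  sign k 1P *P sumFin n (λ j → a *P f j)           ≈⟨ *-distribˡ-sumFin n (sign k 1P) _ ⟩
  sumFin n (λ j → sign k 1P *P (a *P f j))         ≈⟨ sumFin-cong n (λ j → ≋-sym (sign-as-* k (a *P f j))) ⟩
  sumFin n (λ j → sign k (a *P f j))               ∎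

sign-nested : ∀ k l a b D → sign (suc k) (a *P sign l (b *P D)) ≋ -P (sign k 1P *P sign l 1P *P (a *P b *P D))
sign-nested k l a b D = begin
  sign (suc k) (a *P sign l (b *P D))                  ≈⟨ sign-as-* (suc k) _ ⟩
  sign (suc k) 1P *P (a *P sign l (b *P D))            ≈⟨ *-cong (sign-suc k) (*-congˡ {a} (sign-as-* l (b *P D))) ⟩
  -P sign k 1P *P (a *P (sign l 1P *P (b *P D)))       ≈⟨ normalise (sign k 1P) (sign l 1P) a b D ⟩
  -P (sign k 1P *P sign l 1P *P (a *P b *P D))         ∎
  where
  normalise : ∀ s t a b D → -P s *P (a *P (t *P (b *P D))) ≋ -P (s *P t *P (a *P b *P D))
  normalise = solve-∀ ℤ[q]-ACR

det-firstRowExpansion : ∀ n (X : Matrix (suc n)) →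
  det (suc n) X ≋ sumFin (suc n) (λ j → sign (toℕ j) (X zero j *P det n (minorᵀ j X)))
det-firstRowExpansion zero    X = ≋-refl
det-firstRowExpansion (suc m) X = +-congˡ {X zero zero *P det (suc m) (minor zero X)} (begin
  sumFin (suc m) (λ i → sign (suc (toℕ i)) (a i *P det (suc m) (minor (suc i) X)))
    ≈⟨ sumFin-cong (suc m) (λ i → sign-cong (suc (toℕ i)) (*-congˡ {a i} (det-firstRowExpansion m (minor (suc i) X)))) ⟩
  sumFin (suc m) (λ i → sign (suc (toℕ i)) (a i *P sumFin (suc m) (λ j → sign (toℕ j) (b j *P det m (D i j)))))
    ≈⟨ sumFin-cong (suc m) (λ i → ≋-trans (sign-*-sumFin (suc (toℕ i)) (suc m) (a i) (λ j → sign (toℕ j) (b j *P det m (D i j))))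
         (sumFin-cong (suc m) λ j → sign-nested (toℕ i) (toℕ j) (a i) (b j) (det m (D i j)))) ⟩
  sumFin (suc m) (λ i → sumFin (suc m) (F i))      ≈⟨ sumFin-comm (suc m) (suc m) F ⟩
  sumFin (suc m) (λ j → sumFin (suc m) (λ i → F i j))
    ≈⟨ sumFin-cong (suc m) (λ j → ≋-sym (≋-trans (sign-*-sumFin (suc (toℕ j)) (suc m) (b j) (λ i → sign (toℕ i) (a i *P det m (D i j))))
         (sumFin-cong (suc m) λ i → ≋-trans (sign-nested (toℕ j) (toℕ i) (b j) (a i) (det m (D i j)))
           (swap (sign (toℕ j) 1P) (sign (toℕ i) 1P) (b j) (a i) (det m (D i j)))))) ⟩
  sumFin (suc m) (λ j → sign (suc (toℕ j)) (b j *P det (suc m) (minorᵀ (suc j) X)))  ∎)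
  where
  a b : Fin (suc m) → Poly
  a i = X (suc i) zero
  b j = X zero (suc j)
  D : Fin (suc m) → Fin (suc m) → Matrix m
  D i j r c = X (suc (punchIn i r)) (suc (punchIn j c))
  F : Fin (suc m) → Fin (suc m) → Poly
  F i j = -P (sign (toℕ i) 1P *P sign (toℕ j) 1P *P (a i *P b j *P det m (D i j)))
  swap : ∀ s t b a D → -P (s *P t *P (b *P a *P D)) ≋ -P (t *P s *P (a *P b *P D))
  swap = solve-∀ ℤ[q]-ACR

infix 10 _ᵀ
_ᵀ : ∀ {n} → Matrix n → Matrix n
(X ᵀ) i j = X j i

det-transpose : ∀ n (X : Matrix n) → det n (X ᵀ) ≋ det n X
det-transpose zero    X = ≋-refl
det-transpose (suc n) X = ≋-trans
  (sumFin-cong (suc n) λ i → sign-cong (toℕ i) (*-congˡ {X zero i} (det-transpose n (minorᵀ i X))))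
  (≋-sym (det-firstRowExpansion n X))

det-firstRowSingle : ∀ n (X : Matrix (suc n)) → (∀ j → X zero (suc j) ≋ []) → det (suc n) X ≋ X zero zero *P det n (minorᵀ zero X)
det-firstRowSingle n X X₀≈0 = ≋-trans (det-firstRowExpansion n X) (sumFin-single (suc n) _ zero vanishing)
  where
  vanishing : ∀ j → j ≢ zero → sign (toℕ j) (X zero j *P det n (minorᵀ j X)) ≋ []
  vanishing zero    0≢0 = ⊥-elim (0≢0 refl)
  vanishing (suc j) _   = sign-zero (toℕ (suc j)) (≋-trans (*-congʳ (X₀≈0 j)) (zeroˡ (det n (minorᵀ (suc j) X))))

det-unitriangularCongruence : ∀ n (L S : Matrix n) → IsLowerUnitriangular L →
  det n (matMul L (matMul S (L ᵀ))) ≋ det n S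
det-unitriangularCongruence n L S L-unitriangular = begin
  det n (matMul L (matMul S (L ᵀ)))  ≈⟨ det-lowerUnitriangular-matMul n L _ L-unitriangular ⟩
  det n (matMul S (L ᵀ))             ≈⟨ ≋-sym (det-transpose n (matMul S (L ᵀ))) ⟩
  det n (matMul S (L ᵀ) ᵀ)           ≈⟨ det-cong n (λ k l → sumFin-cong n λ m → *-comm (S l m) (L k m)) ⟩
  det n (matMul L (S ᵀ))             ≈⟨ det-lowerUnitriangular-matMul n L (S ᵀ) L-unitriangular ⟩
  det n (S ᵀ)                        ≈⟨ det-transpose n S ⟩
  det n S                            ∎

-- Tridiagonal matrices

leading : ∀ n → (ℕ → ℕ → Poly) → Matrix n
leading n T i j = T (toℕ i) (toℕ j)

tridiagonal : (ℕ → Poly) → (ℕ → Poly) → ℕ → ℕ → Poly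
tridiagonal a c (suc k)       (suc l)       = tridiagonal (a ∘ suc) (c ∘ suc) k l
tridiagonal a c zero          zero          = a 0
tridiagonal a c zero          (suc zero)    = c 0
tridiagonal a c zero          (suc (suc _)) = []
tridiagonal a c (suc zero)    zero          = c 0
tridiagonal a c (suc (suc _)) zero          = []

tridiagonal-diagonal : ∀ a c k → tridiagonal a c k k ≡ a k
tridiagonal-diagonal a c zero    = refl
tridiagonal-diagonal a c (suc k) = tridiagonal-diagonal (a ∘ suc) (c ∘ suc) k

tridiagonal-above : ∀ a c k → tridiagonal a c k (suc k) ≡ c k
tridiagonal-above a c zero    = refl
tridiagonal-above a c (suc k) = tridiagonal-above (a ∘ suc) (c ∘ suc) k

tridiagonal-below : ∀ a c k → tridiagonal a c (suc k) k ≡ c k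
tridiagonal-below a c zero    = refl
tridiagonal-below a c (suc k) = tridiagonal-below (a ∘ suc) (c ∘ suc) k

tridiagonal-farAbove : ∀ a c k l → suc k < l → tridiagonal a c k l ≡ []
tridiagonal-farAbove a c zero    (suc zero)    (ℕ.s≤s ())
tridiagonal-farAbove a c zero    (suc (suc l)) _   = refl
tridiagonal-farAbove a c (suc k) (suc l)       k<l = tridiagonal-farAbove (a ∘ suc) (c ∘ suc) k l (ℕ.s<s⁻¹ k<l)

tridiagonal-farBelow : ∀ a c k l → suc l < k → tridiagonal a c k l ≡ []
tridiagonal-farBelow a c (suc zero)    zero    (ℕ.s≤s ())
tridiagonal-farBelow a c (suc (suc k)) zero    _   = refl
tridiagonal-farBelow a c (suc k)       (suc l) l<k = tridiagonal-farBelow (a ∘ suc) (c ∘ suc) k l (ℕ.s<s⁻¹ l<k)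

det-tridiagonal : ∀ m (a c : ℕ → Poly) →
  det (suc (suc m)) (leading (suc (suc m)) (tridiagonal a c)) ≋
  a 0 *P det (suc m) (leading (suc m) (tridiagonal (a ∘ suc) (c ∘ suc)))
  +P -P (c 0 *P c 0 *P det m (leading m (tridiagonal (λ i → a (2 + i)) (λ i → c (2 + i)))))
det-tridiagonal m a c = begin
  det (suc (suc m)) T
    ≈⟨ sumFin-pair (suc (suc m)) _ zero (suc zero) (λ ()) vanishing ⟩
  a 0 *P det (suc m) (minor zero T) +P -P (c 0 *P det (suc m) (minor (suc zero) T))
    ≈⟨ +-congˡ {a 0 *P det (suc m) (minor zero T)} (-‿cong (*-congˡ {c 0} minor₁-expansion)) ⟩
  a 0 *P det (suc m) (minor zero T) +P -P (c 0 *P (c 0 *P det m T₂))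
    ≈⟨ +-congˡ {a 0 *P det (suc m) (minor zero T)} (-‿cong (≋-sym (*-assoc (c 0) (c 0) (det m T₂)))) ⟩
  a 0 *P det (suc m) (minor zero T) +P -P (c 0 *P c 0 *P det m T₂) ∎
  where
  T : Matrix (suc (suc m))
  T = leading (suc (suc m)) (tridiagonal a c)
  T₂ : Matrix m
  T₂ = leading m (tridiagonal (λ i → a (2 + i)) (λ i → c (2 + i)))
  vanishing : ∀ i → i ≢ zero → i ≢ suc zero → sign (toℕ i) (T i zero *P det (suc m) (minor i T)) ≋ []
  vanishing zero          0≢0 _   = ⊥-elim (0≢0 refl)
  vanishing (suc zero)    _   1≢1 = ⊥-elim (1≢1 refl)
  vanishing (suc (suc i)) _   _   = sign-zero (toℕ i) (zeroˡ (det (suc m) (minor (suc (suc i)) T)))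
  minor₁-expansion : det (suc m) (minor (suc zero) T) ≋ c 0 *P det m T₂
  minor₁-expansion = det-firstRowSingle m (minor (suc zero) T) (λ _ → ≋-refl)

d-recurrence : ∀ m → d (suc (suc m)) ≡ d (suc m) ℤ.- d m
d-recurrence 0 = refl
d-recurrence 1 = refl
d-recurrence 2 = refl
d-recurrence 3 = refl
d-recurrence 4 = refl
d-recurrence 5 = refl
d-recurrence (suc (suc (suc (suc (suc (suc m)))))) = d-recurrence m

-- When 2 yᵢ = xᵢ + xᵢ₊₁ both terms of the continuant recurrence carry the same
-- power of q, which leaves the recurrence dₘ₊₂ = dₘ₊₁ − dₘ.
det-tridiagonal-q^ : ∀ m (a c : ℕ → Poly) (x y : ℕ → ℕ) → (∀ i → a i ≋ q^ (x i)) → (∀ i → c i ≋ q^ (y i)) →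
  (∀ i → y i + y i ≡ x i + x (suc i)) →
  det m (leading m (tridiagonal a c)) ≋ q^ (∑[ i < m ] x (toℕ i)) *P constP (d m)
det-tridiagonal-q^ zero          a c x y a≈ c≈ y+y = ≋-sym (*-identityʳ 1P)
det-tridiagonal-q^ (suc zero)    a c x y a≈ c≈ y+y = ≋-trans (+-identityʳ _) (*-congʳ {1P} (≋-trans (a≈ 0) (≡⇒≋ (cong q^ (≡.sym (ℕ.+-identityʳ (x 0)))))))
det-tridiagonal-q^ (suc (suc m)) a c x y a≈ c≈ y+y = begin
  det (suc (suc m)) (leading (suc (suc m)) (tridiagonal a c))
    ≈⟨ det-tridiagonal m a c ⟩
  a 0 *P det (suc m) (leading (suc m) (tridiagonal (a ∘ suc) (c ∘ suc)))
    +P -P (c 0 *P c 0 *P det m (leading m (tridiagonal (λ i → a (2 + i)) (λ i → c (2 + i)))))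
    ≈⟨ +-cong (*-cong (a≈ 0) (det-tridiagonal-q^ (suc m) (a ∘ suc) (c ∘ suc) (x ∘ suc) (y ∘ suc) (a≈ ∘ suc) (c≈ ∘ suc) (y+y ∘ suc)))
              (-‿cong (*-cong (*-cong (c≈ 0) (c≈ 0)) (det-tridiagonal-q^ m (λ i → a (2 + i)) (λ i → c (2 + i)) (λ i → x (2 + i)) (λ i → y (2 + i)) (λ i → a≈ (2 + i)) (λ i → c≈ (2 + i)) (λ i → y+y (2 + i))))) ⟩
  q^ (x 0) *P (q^ S₁ *P constP (d (suc m))) +P -P (q^ (y 0) *P q^ (y 0) *P (q^ S₂ *P constP (d m)))
    ≈⟨ +-cong (≋-trans (≋-sym (*-assoc (q^ (x 0)) (q^ S₁) (constP (d (suc m))))) (*-congʳ (≋-sym (q^-homo-+ (x 0) S₁))))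
              (-‿cong (≋-trans (≋-sym (*-assoc (q^ (y 0) *P q^ (y 0)) (q^ S₂) (constP (d m))))
                (*-congʳ (≋-trans (*-congʳ (≋-sym (q^-homo-+ (y 0) (y 0))))
                  (≋-trans (≋-sym (q^-homo-+ (y 0 + y 0) S₂)) (≡⇒≋ (cong q^ exponent))))))) ⟩
  Q *P constP (d (suc m)) +P -P (Q *P constP (d m))
    ≈⟨ factor Q (constP (d (suc m))) (constP (d m)) ⟩
  Q *P (constP (d (suc m)) +P -P constP (d m))
    ≈⟨ *-congˡ {Q} (∷-cong (≡.sym (d-recurrence m)) ≋-refl) ⟩
  Q *P constP (d (suc (suc m))) ∎
  where
  S₁ S₂ : ℕ
  S₁ = ∑[ i < suc m ] x (suc (toℕ i))
  S₂ = ∑[ i < m ] x (2 + toℕ i)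
  Q : Poly
  Q = q^ (∑[ i < suc (suc m) ] x (toℕ i))
  exponent : y 0 + y 0 + S₂ ≡ ∑[ i < suc (suc m) ] x (toℕ i)
  exponent = ≡.trans (cong (_+ S₂) (y+y 0)) (ℕ.+-assoc (x 0) (x 1) S₂)
  factor : ∀ Q u v → Q *P u +P -P (Q *P v) ≋ Q *P (u +P -P v)
  factor = solve-∀ ℤ[q]-ACR

-- Orthogonal polynomials

-- Monic polynomials pₖ with p₍ₖ₊₁₎ = (x − b k) pₖ − γ (k − 1) p₍ₖ₋₁₎, i.e. the
-- orthogonal polynomials of a J-fraction with bₖ = b k and λ₍ₖ₊₁₎ = γ k, and
-- the linear functional L with L(xʲ) = μ j.
module OrthogonalPolynomials (b γ μ : ℕ → Poly) where

  xTimes : (ℕ → Poly) → ℕ → Poly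
  xTimes f zero    = []
  xTimes f (suc i) = f i

  -- p k i is the coefficient of xⁱ in pₖ
  p : ℕ → ℕ → Poly
  p zero          zero    = 1P
  p zero          (suc i) = []
  p (suc zero)    i       = xTimes (p 0) i +P -P (b 0 *P p 0 i) +P -P []
  p (suc (suc k)) i       = xTimes (p (suc k)) i +P -P (b (suc k) *P p (suc k) i) +P -P (γ k *P p k i)

  -- ν k j = L(xʲ pₖ)
  ν : ℕ → ℕ → Poly
  ν zero          j = μ j
  ν (suc zero)    j = ν 0 (suc j) +P -P (b 0 *P ν 0 j) +P -P []
  ν (suc (suc k)) j = ν (suc k) (suc j) +P -P (b (suc k) *P ν (suc k) j) +P -P (γ k *P ν k j)

  γ· : (ℕ → ℕ → Poly) → ℕ → ℕ → Poly
  γ· f zero    i = []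
  γ· f (suc k) i = γ k *P f k i

  p-suc : ∀ k i → p (suc k) i ≡ xTimes (p k) i +P -P (b k *P p k i) +P -P (γ· p k i)
  p-suc zero    i = refl
  p-suc (suc k) i = refl

  ν-suc : ∀ k j → ν (suc k) j ≡ ν k (suc j) +P -P (b k *P ν k j) +P -P (γ· ν k j)
  ν-suc zero    j = refl
  ν-suc (suc k) j = refl

  Λ : ℕ → Poly
  Λ zero    = 1P
  Λ (suc k) = γ k *P Λ k

  p-degree : ∀ k i → k < i → p k i ≋ []
  γ·p-degree : ∀ k i → k < i → γ· p k i ≋ []
  p-degree zero    (suc i) _   = ≋-refl
  p-degree (suc k) (suc i) k<i = begin
    p (suc k) (suc i)   ≡⟨ p-suc k (suc i) ⟩
    p k i +P -P (b k *P p k (suc i)) +P -P (γ· p k (suc i))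
      ≈⟨ +-cong (+-cong (p-degree k i (ℕ.s<s⁻¹ k<i)) (-‿cong (≋-trans (*-congˡ {b k} (p-degree k (suc i) k<i′)) (zeroʳ (b k)))))
                (-‿cong (γ·p-degree k (suc i) k<i′)) ⟩
    [] +P -P [] +P -P []  ≈⟨ ≋-refl ⟩
    []                    ∎
    where
    k<i′ : k < suc i
    k<i′ = ℕ.<-trans (ℕ.n<1+n k) k<i
  γ·p-degree zero    i _   = ≋-refl
  γ·p-degree (suc k) i k<i = ≋-trans (*-congˡ {γ k} (p-degree k i (ℕ.<-trans (ℕ.n<1+n k) k<i))) (zeroʳ (γ k))

  p-monic : ∀ k → p k k ≋ 1P
  p-monic zero    = ≋-refl
  p-monic (suc k) = begin
    p (suc k) (suc k)   ≡⟨ p-suc k (suc k) ⟩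
    p k k +P -P (b k *P p k (suc k)) +P -P (γ· p k (suc k))
      ≈⟨ +-cong (+-cong (p-monic k) (-‿cong (≋-trans (*-congˡ {b k} (p-degree k (suc k) (ℕ.n<1+n k))) (zeroʳ (b k)))))
                (-‿cong (γ·p-degree k (suc k) (ℕ.n<1+n k))) ⟩
    1P +P -P [] +P -P []  ≈⟨ ≋-refl ⟩
    1P                    ∎

  ν-as-sum : ∀ k n j → k < n → ν k j ≋ sumFin n (λ i → p k (toℕ i) *P μ (toℕ i + j))
  γ·ν-as-sum : ∀ k n j → k < n → γ· ν k j ≋ sumFin n (λ i → γ· p k (toℕ i) *P μ (toℕ i + j))
  ν-as-sum zero    (suc n) j _ = ≋-sym (begin
    1P *P μ j +P sumFin n (λ i → [] *P μ (suc (toℕ i) + j))  ≈⟨ +-cong (*-identityˡ (μ j)) (sumFin-zero n (λ _ → ≋-refl)) ⟩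
    μ j +P []                                                  ≈⟨ +-identityʳ (μ j) ⟩
    μ j                                                        ∎)
  ν-as-sum (suc k) (suc n) j k<n = ≋-sym (begin
    sumFin (suc n) (λ i → p (suc k) (toℕ i) *P μ (toℕ i + j))
      ≈⟨ sumFin-cong (suc n) (λ i → ≋-trans (*-congʳ (≡⇒≋ (p-suc k (toℕ i))))
           (distribute (xTimes (p k) (toℕ i)) (b k) (p k (toℕ i)) (γ· p k (toℕ i)) (μ (toℕ i + j)))) ⟩
    sumFin (suc n) (λ i → X i +P -P (b k *P Y i) +P -P (Z i))
      ≈⟨ sumFin-threeTerm (suc n) (b k) X Y Z ⟩
    sumFin (suc n) X +P -P (b k *P sumFin (suc n) Y) +P -P (sumFin (suc n) Z)
      ≈⟨ +-cong (+-cong shifted (-‿cong (*-congˡ {b k} (≋-sym (ν-as-sum k (suc n) j k<n′)))))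
                (-‿cong (≋-sym (γ·ν-as-sum k (suc n) j k<n′))) ⟩
    ν k (suc j) +P -P (b k *P ν k j) +P -P (γ· ν k j)   ≡⟨ ≡.sym (ν-suc k j) ⟩
    ν (suc k) j                                        ∎)
    where
    X Y Z : Fin (suc n) → Poly
    X i = xTimes (p k) (toℕ i) *P μ (toℕ i + j)
    Y i = p k (toℕ i) *P μ (toℕ i + j)
    Z i = γ· p k (toℕ i) *P μ (toℕ i + j)
    k<n′ : k < suc n
    k<n′ = ℕ.<-trans (ℕ.n<1+n k) k<n
    distribute : ∀ x c y z m → (x +P -P (c *P y) +P -P z) *P m ≋ x *P m +P -P (c *P (y *P m)) +P -P (z *P m)
    distribute = solve-∀ ℤ[q]-ACR
    shifted : sumFin (suc n) X ≋ ν k (suc j)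
    shifted = begin
      [] *P μ j +P sumFin n (λ i → p k (toℕ i) *P μ (suc (toℕ i + j)))
        ≈⟨ +-identityˡ _ ⟩
      sumFin n (λ i → p k (toℕ i) *P μ (suc (toℕ i + j)))
        ≈⟨ sumFin-cong n (λ i → *-congˡ {p k (toℕ i)} (≡⇒≋ (cong μ (≡.sym (ℕ.+-suc (toℕ i) j))))) ⟩
      sumFin n (λ i → p k (toℕ i) *P μ (toℕ i + suc j))
        ≈⟨ ≋-sym (ν-as-sum k n (suc j) (ℕ.s<s⁻¹ k<n)) ⟩
      ν k (suc j) ∎
  γ·ν-as-sum zero    n j _   = ≋-sym (sumFin-zero n (λ _ → ≋-refl))
  γ·ν-as-sum (suc k) n j k<n = begin
    γ k *P ν k j ≈⟨ *-congˡ {γ k} (ν-as-sum k n j (ℕ.<-trans (ℕ.n<1+n k) k<n)) ⟩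
    γ k *P sumFin n (λ i → p k (toℕ i) *P μ (toℕ i + j))    ≈⟨ *-distribˡ-sumFin n (γ k) _ ⟩
    sumFin n (λ i → γ k *P (p k (toℕ i) *P μ (toℕ i + j)))  ≈⟨ sumFin-cong n (λ i → ≋-sym (*-assoc (γ k) _ _)) ⟩
    sumFin n (λ i → γ k *P p k (toℕ i) *P μ (toℕ i + j))    ∎

  ν-shift : ∀ k j → ν k (suc j) ≋ ν (suc k) j +P b k *P ν k j +P γ· ν k j
  ν-shift k j = ≋-sym (≋-trans (+-congʳ {γ· ν k j} (+-congʳ {b k *P ν k j} (≡⇒≋ (ν-suc k j))))
    (cancel (ν k (suc j)) (b k *P ν k j) (γ· ν k j)))
    where
    cancel : ∀ x y z → x +P -P y +P -P z +P y +P z ≋ x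
    cancel = solve-∀ ℤ[q]-ACR

  P : ∀ n → Matrix n
  P n k i = p (toℕ k) (toℕ i)

  P-lowerUnitriangular : ∀ n → IsLowerUnitriangular (P n)
  P-lowerUnitriangular n = record
    { diagonal = λ k → p-monic (toℕ k)
    ; upper    = λ k i → p-degree (toℕ k) (toℕ i) }

  module Orthogonal (ν-vanishing : ∀ k j → j < k → ν k j ≋ []) (ν-diagonal : ∀ k → ν k k ≋ Λ k) where

    det-hankel : ∀ n → det n (leading n (λ i j → μ (i + j))) ≋ product (λ (k : Fin n) → Λ (toℕ k))
    det-hankel n = begin
      det n H                ≈⟨ ≋-sym (det-lowerUnitriangular-matMul n (P n) H (P-lowerUnitriangular n)) ⟩
      det n (matMul (P n) H) ≈⟨ det-cong n (λ k j → ≋-sym (ν-as-sum (toℕ k) n (toℕ j) (toℕ<n k))) ⟩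
      det n (leading n ν)    ≈⟨ det-upperTriangular n (leading n ν) (λ k j → ν-vanishing (toℕ k) (toℕ j)) ⟩
      product {n} (λ k → ν (toℕ k) (toℕ k)) ≈⟨ Product.sum-cong-≋ {n} (λ k → ν-diagonal (toℕ k)) ⟩
      product {n} (λ k → Λ (toℕ k))         ∎
      where
      H : Matrix n
      H = leading n (λ i j → μ (i + j))

    -- gram n k l = L(pₖ pₗ), computed from the first n moments
    gram : ℕ → ℕ → ℕ → Poly
    gram n k l = sumFin n (λ m → ν k (toℕ m) *P p l (toℕ m))

    gram-swap : ∀ n k l → k < n → l < n → gram n k l ≋ sumFin n (λ i → p k (toℕ i) *P ν l (toℕ i))
    gram-swap n k l k<n l<n = begin
      sumFin n (λ m → ν k (toℕ m) *P p l (toℕ m))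
        ≈⟨ sumFin-cong n (λ m → *-congʳ (ν-as-sum k n (toℕ m) k<n)) ⟩
      sumFin n (λ m → sumFin n (λ i → p k (toℕ i) *P μ (toℕ i + toℕ m)) *P p l (toℕ m))
        ≈⟨ sumFin-cong n (λ m → ≋-trans (*-comm _ (p l (toℕ m))) (*-distribˡ-sumFin n (p l (toℕ m)) _)) ⟩
      sumFin n (λ m → sumFin n (λ i → p l (toℕ m) *P (p k (toℕ i) *P μ (toℕ i + toℕ m))))
        ≈⟨ sumFin-comm n n _ ⟩
      sumFin n (λ i → sumFin n (λ m → p l (toℕ m) *P (p k (toℕ i) *P μ (toℕ i + toℕ m))))
        ≈⟨ sumFin-cong n (λ i → sumFin-cong n (λ m → ≋-trans (swap (p l (toℕ m)) (p k (toℕ i)) (μ (toℕ i + toℕ m))) (*-congˡ {p k (toℕ i)}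
             (*-congˡ {p l (toℕ m)} (≡⇒≋ (cong μ (ℕ.+-comm (toℕ i) (toℕ m)))))))) ⟩
      sumFin n (λ i → sumFin n (λ m → p k (toℕ i) *P (p l (toℕ m) *P μ (toℕ m + toℕ i))))
        ≈⟨ sumFin-cong n (λ i → ≋-sym (*-distribˡ-sumFin n (p k (toℕ i)) _)) ⟩
      sumFin n (λ i → p k (toℕ i) *P sumFin n (λ m → p l (toℕ m) *P μ (toℕ m + toℕ i)))
        ≈⟨ sumFin-cong n (λ i → *-congˡ {p k (toℕ i)} (≋-sym (ν-as-sum l n (toℕ i) l<n))) ⟩
      sumFin n (λ i → p k (toℕ i) *P ν l (toℕ i)) ∎
      where
      swap : ∀ x y z → x *P (y *P z) ≋ y *P (x *P z)
      swap = solve-∀ ℤ[q]-ACR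

    -- Each term has a factor ν k m with m < k or p l m with l < m.
    gram-below : ∀ n k l → l < k → gram n k l ≋ []
    gram-below n k l l<k = sumFin-zero n term≈0
      where
      term≈0 : ∀ m → ν k (toℕ m) *P p l (toℕ m) ≋ []
      term≈0 m with toℕ m ℕ.≤? l
      ... | yes m≤l = ≋-trans (*-congʳ (ν-vanishing k (toℕ m) (ℕ.≤-<-trans m≤l l<k))) (zeroˡ (p l (toℕ m)))
      ... | no  m≰l = ≋-trans (*-congˡ {ν k (toℕ m)} (p-degree l (toℕ m) (ℕ.≰⇒> m≰l))) (zeroʳ (ν k (toℕ m)))

    gram-above : ∀ n k l → k < l → l < n → gram n k l ≋ []
    gram-above n k l k<l l<n = ≋-trans (gram-swap n k l (ℕ.<-trans k<l l<n) l<n) (sumFin-zero n term≈0)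
      where
      term≈0 : ∀ i → p k (toℕ i) *P ν l (toℕ i) ≋ []
      term≈0 i with toℕ i ℕ.≤? k
      ... | yes i≤k = ≋-trans (*-congˡ {p k (toℕ i)} (ν-vanishing l (toℕ i) (ℕ.≤-<-trans i≤k k<l))) (zeroʳ (p k (toℕ i)))
      ... | no  i≰k = ≋-trans (*-congʳ (p-degree k (toℕ i) (ℕ.≰⇒> i≰k))) (zeroˡ (ν l (toℕ i)))

    gram-diagonal : ∀ n k → k < n → gram n k k ≋ Λ k
    gram-diagonal n k k<n = begin
      gram n k k                               ≈⟨ sumFin-single n _ t term≈0 ⟩
      ν k (toℕ t) *P p k (toℕ t)               ≡⟨ cong (λ m → ν k m *P p k m) t≡k ⟩
      ν k k *P p k k                           ≈⟨ *-cong (ν-diagonal k) (p-monic k) ⟩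
      Λ k *P 1P                                ≈⟨ *-identityʳ (Λ k) ⟩
      Λ k                                      ∎
      where
      t : Fin n
      t = Fin.fromℕ< k<n
      t≡k : toℕ t ≡ k
      t≡k = toℕ-fromℕ< k<n
      term≈0 : ∀ m → m ≢ t → ν k (toℕ m) *P p k (toℕ m) ≋ []
      term≈0 m m≢t with ℕ.<-cmp (toℕ m) k
      ... | tri< m<k _ _ = ≋-trans (*-congʳ (ν-vanishing k (toℕ m) m<k)) (zeroˡ (p k (toℕ m)))
      ... | tri≈ _ m≡k _ = ⊥-elim (m≢t (toℕ-injective (≡.trans m≡k (≡.sym t≡k))))
      ... | tri> _ _ k<m = ≋-trans (*-congˡ {ν k (toℕ m)} (p-degree k (toℕ m) k<m)) (zeroʳ (ν k (toℕ m)))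

    γ·gram-above : ∀ n k l → k ≤ l → l < n → γ· (gram n) k l ≋ []
    γ·gram-above n zero    l _   _   = ≋-refl
    γ·gram-above n (suc k) l k<l l<n = ≋-trans (*-congˡ {γ k} (gram-above n k l k<l l<n)) (zeroʳ (γ k))

    γ·gram-below : ∀ n k l → suc l < k → γ· (gram n) k l ≋ []
    γ·gram-below n (suc k) l l<k = ≋-trans (*-congˡ {γ k} (gram-below n k l (ℕ.s<s⁻¹ l<k))) (zeroʳ (γ k))

    sum₃-zero : ∀ {x y z c} → x ≋ [] → y ≋ [] → z ≋ [] → x +P c *P y +P z ≋ []
    sum₃-zero {c = c} x≈0 y≈0 z≈0 = ≋-trans (+-cong (+-cong x≈0 (*-congˡ {c} y≈0)) z≈0) (≋-trans (+-identityʳ _) (zeroʳ c))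

    -- x pₖ = p₍ₖ₊₁₎ + b k pₖ + γ (k − 1) p₍ₖ₋₁₎ and orthogonality make the matrix
    -- L(x pₖ pₗ) tridiagonal.
    jacobi : ℕ → ℕ → Poly
    jacobi = tridiagonal (λ k → b k *P Λ k) (λ k → Λ (suc k))

    jacobi-entry : ∀ n k l → k < n → l < n → gram n (suc k) l +P b k *P gram n k l +P γ· (gram n) k l ≋ jacobi k l
    jacobi-entry n k l k<n l<n with ℕ.<-cmp k l
    ... | tri≈ _ refl _ = begin
      gram n (suc k) k +P b k *P gram n k k +P γ· (gram n) k k
        ≈⟨ +-cong (+-cong (gram-below n (suc k) k (ℕ.n<1+n k)) (*-congˡ {b k} (gram-diagonal n k k<n)))
                  (γ·gram-above n k k ℕ.≤-refl l<n) ⟩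
      [] +P b k *P Λ k +P []   ≈⟨ +-identityʳ _ ⟩
      b k *P Λ k               ≡⟨ ≡.sym (tridiagonal-diagonal _ _ k) ⟩
      jacobi k k               ∎
    ... | tri< k<l _ _ with l ℕ.≟ suc k
    ...   | yes refl = begin
      gram n (suc k) (suc k) +P b k *P gram n k (suc k) +P γ· (gram n) k (suc k)
        ≈⟨ +-cong (+-cong (gram-diagonal n (suc k) l<n) (*-congˡ {b k} (gram-above n k (suc k) k<l l<n)))
                  (γ·gram-above n k (suc k) (ℕ.<⇒≤ k<l) l<n) ⟩
      Λ (suc k) +P b k *P [] +P []  ≈⟨ ≋-trans (+-identityʳ _) (≋-trans (+-congˡ {Λ (suc k)} (zeroʳ (b k))) (+-identityʳ _)) ⟩
      Λ (suc k)                     ≡⟨ ≡.sym (tridiagonal-above _ _ k) ⟩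
      jacobi k (suc k)              ∎
    ...   | no l≢k+1 = ≋-trans (sum₃-zero {c = b k} (gram-above n (suc k) l k+1<l l<n) (gram-above n k l k<l l<n)
                                          (γ·gram-above n k l (ℕ.<⇒≤ k<l) l<n))
                               (≡⇒≋ (≡.sym (tridiagonal-farAbove _ _ k l k+1<l)))
      where
      k+1<l : suc k < l
      k+1<l = ℕ.≤∧≢⇒< k<l (l≢k+1 ∘ ≡.sym)
    jacobi-entry n k l k<n l<n | tri> _ _ l<k with k ℕ.≟ suc l
    ...   | yes refl = begin
      gram n (suc k) l +P b k *P gram n k l +P γ l *P gram n l l
        ≈⟨ +-cong (+-cong (gram-below n (suc k) l (ℕ.<-trans l<k (ℕ.n<1+n k))) (*-congˡ {b k} (gram-below n k l l<k)))
                  (*-congˡ {γ l} (gram-diagonal n l l<n)) ⟩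
      [] +P b k *P [] +P γ l *P Λ l  ≈⟨ +-congʳ {γ l *P Λ l} (zeroʳ (b k)) ⟩
      Λ (suc l)                      ≡⟨ ≡.sym (tridiagonal-below _ _ l) ⟩
      jacobi (suc l) l               ∎
    ...   | no k≢l+1 = ≋-trans (sum₃-zero {c = b k} (gram-below n (suc k) l (ℕ.<-trans l<k (ℕ.n<1+n k))) (gram-below n k l l<k)
                                          (γ·gram-below n k l l+1<k))
                               (≡⇒≋ (≡.sym (tridiagonal-farBelow _ _ k l l+1<k)))
      where
      l+1<k : suc l < k
      l+1<k = ℕ.≤∧≢⇒< l<k (k≢l+1 ∘ ≡.sym)


    γ·gram-as-sum : ∀ n k l → γ· (gram n) k l ≋ sumFin n (λ m → γ· ν k (toℕ m) *P p l (toℕ m))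
    γ·gram-as-sum n zero    l = ≋-sym (sumFin-zero n (λ m → zeroˡ (p l (toℕ m))))
    γ·gram-as-sum n (suc k) l = ≋-trans (*-distribˡ-sumFin n (γ k) _)
      (sumFin-cong n (λ m → ≋-sym (*-assoc (γ k) (ν k (toℕ m)) (p l (toℕ m)))))

    congruence-entry : ∀ n (k l : Fin n) →
      matMul (P n) (matMul (leading n (λ i j → μ (i + j + 1))) (P n ᵀ)) k l ≋
      gram n (suc (toℕ k)) (toℕ l) +P b (toℕ k) *P gram n (toℕ k) (toℕ l) +P γ· (gram n) (toℕ k) (toℕ l)
    congruence-entry n k l = begin
      sumFin n (λ i → p k′ (toℕ i) *P sumFin n (λ m → μ (toℕ i + toℕ m + 1) *P p l′ (toℕ m)))
        ≈⟨ sumFin-cong n (λ i → *-distribˡ-sumFin n (p k′ (toℕ i)) _) ⟩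
      sumFin n (λ i → sumFin n (λ m → p k′ (toℕ i) *P (μ (toℕ i + toℕ m + 1) *P p l′ (toℕ m))))
        ≈⟨ sumFin-comm n n _ ⟩
      sumFin n (λ m → sumFin n (λ i → p k′ (toℕ i) *P (μ (toℕ i + toℕ m + 1) *P p l′ (toℕ m))))
        ≈⟨ sumFin-cong n (λ m → sumFin-cong n (λ i → ≋-trans (≋-sym (*-assoc (p k′ (toℕ i)) (μ (toℕ i + toℕ m + 1)) (p l′ (toℕ m))))
             (*-congʳ (*-congˡ {p k′ (toℕ i)} (≡⇒≋ (cong μ (+-1 (toℕ i) (toℕ m)))))))) ⟩
      sumFin n (λ m → sumFin n (λ i → p k′ (toℕ i) *P μ (toℕ i + suc (toℕ m)) *P p l′ (toℕ m)))
        ≈⟨ sumFin-cong n (λ m → ≋-trans (≋-sym (*-distribʳ-sumFin n (p l′ (toℕ m)) _))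
             (*-congʳ (≋-sym (ν-as-sum k′ n (suc (toℕ m)) (toℕ<n k))))) ⟩
      sumFin n (λ m → ν k′ (suc (toℕ m)) *P p l′ (toℕ m))
        ≈⟨ sumFin-cong n (λ m → ≋-trans (*-congʳ (ν-shift k′ (toℕ m))) (distribute (ν (suc k′) (toℕ m)) (b k′) (ν k′ (toℕ m)) (γ· ν k′ (toℕ m)) (p l′ (toℕ m)))) ⟩
      sumFin n (λ m → ν (suc k′) (toℕ m) *P p l′ (toℕ m) +P b k′ *P (ν k′ (toℕ m) *P p l′ (toℕ m))
                        +P γ· ν k′ (toℕ m) *P p l′ (toℕ m))
        ≈⟨ sumFin-linear n (b k′) _ _ _ ⟩
      gram n (suc k′) l′ +P b k′ *P gram n k′ l′ +P sumFin n (λ m → γ· ν k′ (toℕ m) *P p l′ (toℕ m))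
        ≈⟨ +-congˡ {gram n (suc k′) l′ +P b k′ *P gram n k′ l′} (≋-sym (γ·gram-as-sum n k′ l′)) ⟩
      gram n (suc k′) l′ +P b k′ *P gram n k′ l′ +P γ· (gram n) k′ l′ ∎
      where
      k′ l′ : ℕ
      k′ = toℕ k
      l′ = toℕ l
      +-1 : ∀ i m → i + m + 1 ≡ i + suc m
      +-1 i m = ≡.trans (ℕ.+-assoc i m 1) (cong (λ k → i + k) (ℕ.+-comm m 1))
      distribute : ∀ x c y z a → (x +P c *P y +P z) *P a ≋ x *P a +P c *P (y *P a) +P z *P a
      distribute = solve-∀ ℤ[q]-ACR

    det-shiftedHankel : ∀ n → det n (leading n (λ i j → μ (i + j + 1))) ≋ det n (leading n jacobi)
    det-shiftedHankel n = begin
      det n H⁺                                   ≈⟨ ≋-sym (det-unitriangularCongruence n (P n) H⁺ (P-lowerUnitriangular n)) ⟩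
      det n (matMul (P n) (matMul H⁺ (P n ᵀ)))   ≈⟨ det-cong n (λ k l → ≋-trans (congruence-entry n k l)
                                                      (jacobi-entry n (toℕ k) (toℕ l) (toℕ<n k) (toℕ<n l))) ⟩
      det n (leading n jacobi)                   ∎
      where
      H⁺ : Matrix n
      H⁺ = leading n (λ i j → μ (i + j + 1))

-- Formal power series

infix 4 _≋S_
_≋S_ : FPS → FPS → Set
F ≋S G = ∀ t → F t ≋ G t

sumTo-cong : ∀ n {f g : ℕ → Poly} → (∀ i → i ≤ n → f i ≋ g i) → sumTo n f ≋ sumTo n g
sumTo-cong zero    f≈g = f≈g zero ℕ.z≤n
sumTo-cong (suc n) f≈g = +-cong (sumTo-cong n λ i i≤n → f≈g i (ℕ.m≤n⇒m≤1+n i≤n)) (f≈g (suc n) ℕ.≤-refl)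

sumTo-distrib-+ : ∀ n (f g : ℕ → Poly) → sumTo n (λ i → f i +P g i) ≋ sumTo n f +P sumTo n g
sumTo-distrib-+ zero    f g = ≋-refl
sumTo-distrib-+ (suc n) f g = ≋-trans (+-congʳ (sumTo-distrib-+ n f g))
  (interchange (sumTo n f) (sumTo n g) (f (suc n)) (g (suc n)))

*-distribˡ-sumTo : ∀ n c (f : ℕ → Poly) → c *P sumTo n f ≋ sumTo n (λ i → c *P f i)
*-distribˡ-sumTo zero    c f = ≋-refl
*-distribˡ-sumTo (suc n) c f = ≋-trans (distribˡ c (sumTo n f) (f (suc n))) (+-congʳ (*-distribˡ-sumTo n c f))

*S-congʳ : ∀ F {G H} → G ≋S H → F *S G ≋S F *S H
*S-congʳ F G≈H t = sumTo-cong t λ i _ → *-congˡ {F i} (G≈H (t ∸ i))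

*S-distrib-+S : ∀ F G H → F *S (G +S H) ≋S (F *S G) +S (F *S H)
*S-distrib-+S F G H t = ≋-trans (sumTo-cong t λ i _ → distribˡ (F i) (G (t ∸ i)) (H (t ∸ i)))
  (sumTo-distrib-+ t (λ i → F i *P G (t ∸ i)) (λ i → F i *P H (t ∸ i)))

*S-·S : ∀ F c G → F *S (c ·S G) ≋S c ·S (F *S G)
*S-·S F c G t = ≋-trans (sumTo-cong t λ i _ → swap (F i) c (G (t ∸ i)))
  (≋-sym (*-distribˡ-sumTo t c (λ i → F i *P G (t ∸ i))))
  where
  swap : ∀ x c y → x *P (c *P y) ≋ c *P (x *P y)
  swap = solve-∀ ℤ[q]-ACR

*S-zS : ∀ F G → F *S zS G ≋S zS (F *S G)
*S-zS F G zero    = zeroʳ (F 0)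
*S-zS F G (suc t) = ≋-trans (+-cong (sumTo-cong t shift) (≋-trans (≡⇒≋ (cong (λ s → F (suc t) *P zS G s) (ℕ.n∸n≡0 t)))
                                                            (zeroʳ (F (suc t)))))
                            (+-identityʳ _)
  where
  shift : ∀ i → i ≤ t → F i *P zS G (suc t ∸ i) ≋ F i *P G (t ∸ i)
  shift i i≤t = ≡⇒≋ (cong (λ s → F i *P zS G s) (ℕ.+-∸-assoc 1 i≤t))

sumTo-zero : ∀ n {f : ℕ → Poly} → (∀ i → i ≤ n → f i ≋ []) → sumTo n f ≋ []
sumTo-zero n f≈0 = ≋-trans (sumTo-cong n f≈0) (zeros n)
  where
  zeros : ∀ n → sumTo n (λ _ → []) ≋ []
  zeros zero    = ≋-refl
  zeros (suc n) = ≋-trans (+-identityʳ _) (zeros n)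

*S-substQz-oneS : ∀ F → F *S substQz oneS ≋S F
*S-substQz-oneS F zero    = ≋-trans (*-congˡ {F 0} (*-identityˡ 1P)) (*-identityʳ (F 0))
*S-substQz-oneS F (suc t) = ≋-trans (+-cong (sumTo-zero t vanishing) last) (+-identityˡ (F (suc t)))
  where
  vanishing : ∀ i → i ≤ t → F i *P substQz oneS (suc t ∸ i) ≋ []
  vanishing i i≤t = ≋-trans (≡⇒≋ (cong (λ s → F i *P substQz oneS s) (ℕ.+-∸-assoc 1 i≤t)))
    (≋-trans (*-congˡ {F i} (zeroʳ (q^ (suc (t ∸ i))))) (zeroʳ (F i)))
  last : F (suc t) *P substQz oneS (suc t ∸ suc t) ≋ F (suc t)
  last = ≋-trans (≡⇒≋ (cong (λ s → F (suc t) *P substQz oneS s) (ℕ.n∸n≡0 t)))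
    (≋-trans (*-congˡ {F (suc t)} (*-identityˡ 1P)) (*-identityʳ (F (suc t))))

zS-cong : ∀ {F G} → F ≋S G → zS F ≋S zS G
zS-cong F≈G zero    = ≋-refl
zS-cong F≈G (suc t) = F≈G t

substQz-cong : ∀ {F G} → F ≋S G → substQz F ≋S substQz G
substQz-cong F≈G t = *-congˡ {q^ t} (F≈G t)

substQz-threeTerm : ∀ H a F c G →
  substQz (H +S ((a ·S zS F) +S (c ·S zS (zS G)))) ≋S
  substQz H +S (((a *P qP) ·S zS (substQz F)) +S ((c *P qP *P qP) ·S zS (zS (substQz G))))
substQz-threeTerm H a F c G zero          = at₀ (q^ 0) (H 0) a c qP
  where
  at₀ : ∀ u h a c q → u *P (h +P (a *P [] +P c *P [])) ≋ u *P h +P (a *P q *P [] +P c *P q *P q *P [])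
  at₀ = solve-∀ ℤ[q]-ACR
substQz-threeTerm H a F c G (suc zero)    = at₁ (q^ 0) (H 1) a (F 0) c qP
  where
  at₁ : ∀ u h a f c q → q *P u *P (h +P (a *P f +P c *P [])) ≋ q *P u *P h +P (a *P q *P (u *P f) +P c *P q *P q *P [])
  at₁ = solve-∀ ℤ[q]-ACR
substQz-threeTerm H a F c G (suc (suc t)) = atₜ (q^ t) (H (suc (suc t))) a (F (suc t)) c (G t) qP
  where
  atₜ : ∀ u h a f c g q → q *P (q *P u) *P (h +P (a *P f +P c *P g)) ≋
                        q *P (q *P u) *P h +P (a *P q *P (q *P u *P f) +P c *P q *P q *P (u *P g))
  atₜ = solve-∀ ℤ[q]-ACR

*S-threeTerm : ∀ M H a F c G →
  M *S (H +S ((a ·S zS F) +S (c ·S zS (zS G)))) ≋S (M *S H) +S ((a ·S zS (M *S F)) +S (c ·S zS (zS (M *S G))))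
*S-threeTerm M H a F c G t = ≋-trans (*S-distrib-+S M H ((a ·S zS F) +S (c ·S zS (zS G))) t) (+-congˡ {(M *S H) t}
  (≋-trans (*S-distrib-+S M (a ·S zS F) (c ·S zS (zS G)) t)
    (+-cong (≋-trans (*S-·S M a (zS F) t) (*-congˡ {a} (*S-zS M F t)))
            (≋-trans (*S-·S M c (zS (zS G)) t) (*-congˡ {c} (≋-trans (*S-zS M (zS G) t) (zS-cong (*S-zS M G) t)))))))

-- The q-Motzkin series

module MotzkinSeries (M : FPS) (isMotzkin : IsQMotzkinGF M) where

  V : ℕ → FPS
  V zero    = M
  V (suc k) = M *S substQz (V k)

  V₋ : ℕ → FPS
  V₋ zero    = oneS
  V₋ (suc k) = V k

  V-unfold : ∀ k → V k ≋S M *S substQz (V₋ k)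
  V-unfold zero    t = ≋-sym (*S-substQz-oneS M t)
  V-unfold (suc k) t = ≋-refl

  -- The functional equation is the case k = 0; substituting z ↦ qz and
  -- multiplying by M gives the next case.
  V-recurrence : ∀ k → V k ≋S V₋ k +S ((q^ k ·S zS (V k)) +S (q^ (suc (2 * k)) ·S zS (zS (V (suc k)))))
  V-recurrence zero    t = ≋-trans (mk (isMotzkin t)) (+-congˡ {oneS t}
    (+-cong (≋-sym (*-identityˡ (zS M t))) (*-congʳ (≋-sym (*-identityʳ qP)))))
  V-recurrence (suc k) t = begin
    (M *S substQz (V k)) t
      ≈⟨ *S-congʳ M (λ s → ≋-trans (substQz-cong (V-recurrence k) s)
           (substQz-threeTerm (V₋ k) (q^ k) (V k) (q^ (suc (2 * k))) (V (suc k)) s)) t ⟩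
    (M *S (substQz (V₋ k) +S (((q^ k *P qP) ·S zS (substQz (V k))) +S
            ((q^ (suc (2 * k)) *P qP *P qP) ·S zS (zS (substQz (V (suc k)))))))) t
      ≈⟨ *S-threeTerm M (substQz (V₋ k)) (q^ k *P qP) (substQz (V k)) (q^ (suc (2 * k)) *P qP *P qP) (substQz (V (suc k))) t ⟩
    (M *S substQz (V₋ k)) t +P ((q^ k *P qP) *P zS (V (suc k)) t +P
                                (q^ (suc (2 * k)) *P qP *P qP) *P zS (zS (V (suc (suc k)))) t)
      ≈⟨ +-cong (≋-sym (V-unfold k t)) (+-cong (*-congʳ (*-comm (q^ k) qP)) (*-congʳ exponent)) ⟩
    V k t +P (q^ (suc k) *P zS (V (suc k)) t +P q^ (suc (2 * suc k)) *P zS (zS (V (suc (suc k)))) t) ∎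
    where
    exponent : q^ (suc (2 * k)) *P qP *P qP ≋ q^ (suc (2 * suc k))
    exponent = ≋-trans (cube qP (q^ (2 * k))) (≡⇒≋ (cong (q^ ∘ suc) (≡.sym (ℕ.*-suc 2 k))))
      where
      cube : ∀ q u → q *P u *P q *P q ≋ q *P (q *P (q *P u))
      cube = solve-∀ ℤ[q]-ACR

  V-constantTerm : ∀ k → V k 0 ≋ 1P
  V-constantTerm k = ≋-trans (V-recurrence k 0) (≋-trans (+-congˡ {V₋ k 0} (vanish (q^ k) (q^ (suc (2 * k)))))
    (≋-trans (+-identityʳ (V₋ k 0)) (previous k)))
    where
    vanish : ∀ a c → a *P [] +P c *P [] ≋ []
    vanish = solve-∀ ℤ[q]-ACR
    previous : ∀ k → V₋ k 0 ≋ 1P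
    previous zero    = ≋-refl
    previous (suc k) = V-constantTerm k

zPow : ℕ → FPS → FPS
zPow zero    F = F
zPow (suc k) F = zS (zPow k F)

zPow-below : ∀ k F j → j < k → zPow k F j ≡ []
zPow-below (suc k) F zero    _   = refl
zPow-below (suc k) F (suc j) j<k = zPow-below k F j (ℕ.s<s⁻¹ j<k)

zPow-at : ∀ k F t → zPow k F (k + t) ≡ F t
zPow-at zero    F t = refl
zPow-at (suc k) F t = zPow-at k F t

zPow-threeTerm : ∀ k H a F c G → zPow k (H +S ((a ·S zS F) +S (c ·S zS (zS G)))) ≋S
  zPow k H +S ((a ·S zPow (suc k) F) +S (c ·S zPow (suc (suc k)) G))
zPow-threeTerm zero    H a F c G t       = ≋-refl
zPow-threeTerm (suc k) H a F c G zero    = vanish a c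
  where
  vanish : ∀ a c → [] ≋ [] +P (a *P [] +P c *P [])
  vanish = solve-∀ ℤ[q]-ACR
zPow-threeTerm (suc k) H a F c G (suc t) = zPow-threeTerm k H a F c G t

zPow-cong : ∀ k {F G} → F ≋S G → zPow k F ≋S zPow k G
zPow-cong zero    F≈G = F≈G
zPow-cong (suc k) F≈G = zS-cong (zPow-cong k F≈G)

module MotzkinMoments (M : FPS) (isMotzkin : IsQMotzkinGF M) where

  open MotzkinSeries M isMotzkin
  open OrthogonalPolynomials (λ k → q^ k) (λ k → q^ (suc (2 * k))) M

  ν≈ΛzᵏV : ∀ k j → ν k j ≋ Λ k *P zPow k (V k) j
  ν≈ΛzᵏV zero          j = ≋-sym (*-identityˡ (M j))
  ν≈ΛzᵏV (suc zero)    j = begin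
    M (suc j) +P -P (1P *P M j) +P -P []
      ≈⟨ +-congʳ { -P []} (+-congʳ { -P (1P *P M j)} (V-recurrence 0 (suc j))) ⟩
    [] +P (1P *P M j +P q^ 1 *P zS (V 1) j) +P -P (1P *P M j) +P -P []
      ≈⟨ cancel (1P *P M j) (q^ 1) (zS (V 1) j) ⟩
    q^ 1 *P 1P *P zS (V 1) j ∎
    where
    cancel : ∀ m q w → [] +P (m +P q *P w) +P -P m +P -P [] ≋ q *P 1P *P w
    cancel = solve-∀ ℤ[q]-ACR
  ν≈ΛzᵏV (suc (suc k)) j = begin
    ν (suc k) (suc j) +P -P (q^ (suc k) *P ν (suc k) j) +P -P (γ *P ν k j)
      ≈⟨ +-cong (+-cong (ν≈ΛzᵏV (suc k) (suc j)) (-‿cong (*-congˡ {q^ (suc k)} (ν≈ΛzᵏV (suc k) j))))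
                (-‿cong (*-congˡ {γ} (ν≈ΛzᵏV k j))) ⟩
    γ *P Λ k *P zPow k (V (suc k)) j +P -P (q^ (suc k) *P (γ *P Λ k *P zPow (suc k) (V (suc k)) j))
      +P -P (γ *P (Λ k *P zPow k (V k) j))
      ≈⟨ +-congʳ { -P (γ *P (Λ k *P zPow k (V k) j))} (+-congʳ { -P (q^ (suc k) *P (γ *P Λ k *P zPow (suc k) (V (suc k)) j))}
           (*-congˡ {γ *P Λ k} recurrence)) ⟩
    γ *P Λ k *P (zPow k (V k) j +P (q^ (suc k) *P zPow (suc k) (V (suc k)) j +P γ′ *P zPow (suc (suc k)) (V (suc (suc k))) j))
      +P -P (q^ (suc k) *P (γ *P Λ k *P zPow (suc k) (V (suc k)) j)) +P -P (γ *P (Λ k *P zPow k (V k) j))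
      ≈⟨ cancel γ (Λ k) (q^ (suc k)) γ′ (zPow k (V k) j) (zPow (suc k) (V (suc k)) j) (zPow (suc (suc k)) (V (suc (suc k))) j) ⟩
    γ′ *P (γ *P Λ k) *P zPow (suc (suc k)) (V (suc (suc k))) j ∎
    where
    γ γ′ : Poly
    γ  = q^ (suc (2 * k))
    γ′ = q^ (suc (2 * suc k))
    recurrence : zPow k (V (suc k)) j ≋
      zPow k (V k) j +P (q^ (suc k) *P zPow (suc k) (V (suc k)) j +P γ′ *P zPow (suc (suc k)) (V (suc (suc k))) j)
    recurrence = ≋-trans (zPow-cong k (V-recurrence (suc k)) j)
      (zPow-threeTerm k (V k) (q^ (suc k)) (V (suc k)) γ′ (V (suc (suc k))) j)
    cancel : ∀ g L s u C B D → g *P L *P (C +P (s *P B +P u *P D)) +P -P (s *P (g *P L *P B)) +P -P (g *P (L *P C))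
                               ≋ u *P (g *P L) *P D
    cancel = solve-∀ ℤ[q]-ACR

  ν-vanishing : ∀ k j → j < k → ν k j ≋ []
  ν-vanishing k j j<k = ≋-trans (ν≈ΛzᵏV k j) (≋-trans (*-congˡ {Λ k} (≡⇒≋ (zPow-below k (V k) j j<k))) (zeroʳ (Λ k)))

  ν-diagonal : ∀ k → ν k k ≋ Λ k
  ν-diagonal k = begin
    ν k k                        ≈⟨ ν≈ΛzᵏV k k ⟩
    Λ k *P zPow k (V k) k        ≡⟨ cong (λ j → Λ k *P zPow k (V k) j) (≡.sym (ℕ.+-identityʳ k)) ⟩
    Λ k *P zPow k (V k) (k + 0)  ≡⟨ cong (Λ k *P_) (zPow-at k (V k) 0) ⟩
    Λ k *P V k 0                 ≈⟨ *-congˡ {Λ k} (V-constantTerm k) ⟩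
    Λ k *P 1P                    ≈⟨ *-identityʳ (Λ k) ⟩
    Λ k                          ∎

  Λ≈q^square : ∀ k → Λ k ≋ q^ (k * k)
  Λ≈q^square zero    = ≋-refl
  Λ≈q^square (suc k) = begin
    q^ (suc (2 * k)) *P Λ k            ≈⟨ *-congˡ {q^ (suc (2 * k))} (Λ≈q^square k) ⟩
    q^ (suc (2 * k)) *P q^ (k * k)     ≈⟨ ≋-sym (q^-homo-+ (suc (2 * k)) (k * k)) ⟩
    q^ (suc (2 * k) + k * k)           ≡⟨ cong q^ (square-suc k) ⟩
    q^ (suc k * suc k)                 ∎
    where
    square-suc : ∀ k → suc (2 * k) + k * k ≡ suc k * suc k
    square-suc = ℕ-Solver.solve-∀

  open Orthogonal ν-vanishing ν-diagonal

  det-motzkinHankel : ∀ m → det m (leading m (λ i j → M (i + j))) ≋ q^ (∑[ i < m ] (toℕ i * toℕ i))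
  det-motzkinHankel m = begin
    det m (leading m (λ i j → M (i + j)))  ≈⟨ det-hankel m ⟩
    product {m} (λ k → Λ (toℕ k))          ≈⟨ Product.sum-cong-≋ {m} (λ k → Λ≈q^square (toℕ k)) ⟩
    product {m} (λ k → q^ (toℕ k * toℕ k)) ≈⟨ product-q^ m (λ k → k * k) ⟩
    q^ (∑[ i < m ] (toℕ i * toℕ i))        ∎

  det-motzkinShiftedHankel : ∀ m → det m (leading m (λ i j → M (i + j + 1))) ≋ q^ (∑[ i < m ] (toℕ i * toℕ i + toℕ i)) *P constP (d m)
  det-motzkinShiftedHankel m = ≋-trans (det-shiftedHankel m)
    (det-tridiagonal-q^ m _ _ (λ i → i * i + i) (λ i → suc i * suc i) diagonal (λ i → Λ≈q^square (suc i)) exponent-balance)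
    where
    diagonal : ∀ i → q^ i *P Λ i ≋ q^ (i * i + i)
    diagonal i = ≋-trans (*-congˡ {q^ i} (Λ≈q^square i)) (≋-trans (≋-sym (q^-homo-+ i (i * i))) (≡⇒≋ (cong q^ (ℕ.+-comm i (i * i)))))
    exponent-balance : ∀ i → suc i * suc i + suc i * suc i ≡ i * i + i + (suc i * suc i + suc i)
    exponent-balance = ℕ-Solver.solve-∀

mainTheorem6 : (M : FPS) → IsQMotzkinGF M → (n : ℕ) →
    (det (suc n) (λ i j → M (toℕ i + toℕ j))
       ≈ q^ ((n * (n + 1) * (2 * n + 1)) / 6))
    × (det (suc n) (λ i j → M (toℕ i + toℕ j + 1))
       ≈ q^ (2 * ((n + 2) C 3)) *P constP (d (suc n)))
mainTheorem6 M isMotzkin n =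
  get (≋-trans (det-motzkinHankel (suc n)) (≡⇒≋ (cong q^ (sumOfSquares n)))) ,
  get (≋-trans (det-motzkinShiftedHankel (suc n)) (≡⇒≋ (cong (λ e → q^ e *P constP (d (suc n))) (sumOfPronics n))))
  where open MotzkinMoments M isMotzkin
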